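{- If $\vdash_\sigma P$ and $\langle\sigma;P\rangle\xrightarrow{\mu}\langle\sigma';P'\rangle$, then $\vdash_{\sigma'}P'$.
   Context: Asynchronous $\pi$-calculus: processes $P ::= a\langle\tilde b\rangle \mid\ !a(\tilde b).P \mid P|Q \mid (\nu a)P \mid G$, $G ::= \mathbf 0 \mid a(\tilde b).P \mid \tau.P \mid [a=b]G \mid G+G'$, well-sorted under a fixed sorting; $\xrightarrow{\mu}$ is the standard early LTS of the asynchronous $\pi$-calculus (actions $\tau$, early inputs $a(\tilde b)$, outputs $(\nu\tilde c)a\langle\tilde b\rangle$ with subject $a$); $\mathrm{fn}$ denotes free names. Names: output-controlled ($x,y,z$), input-controlled ($u,v,w$), continuation ($p,q,r$); $a,b,c$ range over output- and input-controlled names. Outputs at output-controlled names carry tuples $\tilde a,p$ ending with exactly one continuation name; continuation names are transmitted only this way. Sequentiality typing (continuation names count as output-controlled): $\vdash_1 u(\tilde a).P$ if $\vdash_1P$; $\vdash_0 x(\tilde a).P$, $\vdash_0 !x(\tilde a).P$ if $\vdash_1P$; $\vdash_1x\langle\tilde a\rangle$; $\vdash_0u\langle\tilde a\rangle$; $\vdash_\eta(\nu a)P$ if $\vdash_\eta P$; $\vdash_0\mathbf0$; $\vdash_{\eta_1+\eta_2}P|Q$ if $\vdash_{\eta_1}P,\vdash_{\eta_2}Q$, $\eta_1+\eta_2\le1$; $\vdash_\eta G_1+G_2$ if $\vdash_\eta G_1,G_2$; $\vdash_\eta\tau.P$ if $\vdash_\eta P$; $\vdash_0[a=b]G$ if $\vdash_0G$.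 Sequential type-allowed transition $\eta\vdash P\xrightarrow{\mu}P'$: $\vdash_\eta P$, $P\xrightarrow{\mu}P'$, and $\eta=0$, or $\mu=\tau$, or $\eta=1$ and $\mu$ is an input at an input-controlled name or an output at an output-controlled name. Stacks: sequences of $p^{\mathrm O}$/$p^{\mathrm I}$ with alternating tags, ending with an output tag unless empty, each name at most once per tag, and if a name has both tags the input occurrence immediately follows the output one; $|\sigma|$ is the length; $\mathrm{seq}(\sigma)=1$ if $\sigma$ starts with an output tag, else $0$. Interleaving $\sigma_1\in\sigma_2\between\sigma_3$: $\sigma_1$ is a stack derivable by $\emptyset\in\emptyset\between\emptyset$, and $t,\sigma_1\in\sigma_2\between t,\sigma_3$, $t,\sigma_1\in t,\sigma_2\between\sigma_3$ from $\sigma_1\in\sigma_2\between\sigma_3$ ($t$ a tagged name). Well-bracketing typing $\vdash_\sigma P$: $\vdash_{p^{\mathrm O}}p\langle\tilde a\rangle$; $\vdash_{p^{\mathrm O}}x\langle\tilde a,p\rangle$; $\vdash_\emptyset u\langle\tilde a\rangle$; $\vdash_{q^{\mathrm I},p^{\mathrm O}}q(\tilde a).P$ if $\vdash_{p^{\mathrm O}}P$, $p\ne q$; $\vdash_\emptyset x(\tilde a,p).P$, $\vdash_\emptyset !x(\tilde a,p).P$ if $\vdash_{p^{\mathrm O}}P$; $\vdash_{p^{\mathrm O}}u(\tilde a).P$ if $\vdash_{p^{\mathrm O}}P$; $\vdash_\emptyset\mathbf0$; $\vdash_{\xi,\sigma'}(\nu p)P$ if $\vdash_{\xi,p^{\mathrm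 O},p^{\mathrm I},\sigma'}P$ with $\xi$ empty or ending with an input tag; $\vdash_\sigma(\nu p)P$ if $\vdash_\sigma P$, $p\notin\sigma$; $\vdash_\sigma(\nu a)P$ if $\vdash_\sigma P$; $\vdash_\emptyset[a=b]P$ if $\vdash_\emptyset P$; $\vdash_{\sigma''}P|Q$ if $\vdash_\sigma P,\vdash_{\sigma'}Q$, $\sigma''\in\sigma\between\sigma'$; $\vdash_\sigma\tau.P$ if $\vdash_\sigma P$, $|\sigma|\le1$; $\vdash_\sigma P+Q$ if $\vdash_\sigma P,Q$, $|\sigma|\le1$. Typed transition $\sigma\vdash P\xrightarrow{\mu}P'$: $\vdash_\sigma P$; $\mathrm{seq}(\sigma)\vdash P\xrightarrow{\mu}P'$; and if a continuation name $p\in\mathrm{fn}(\mu)$ occurs in $\sigma$, then $\sigma=p^{\mathrm O},\sigma'$ or $\sigma=p^{\mathrm I},\sigma'$, and if moreover $p$ occurs in $\sigma'$ then $p$ is not the subject of $\mu$. $\langle\sigma;P\rangle\xrightarrow{\mu}\langle\sigma';P'\rangle$ holds when $\sigma\vdash P\xrightarrow{\mu}P'$ and: (1) if $\mu=(\nu\tilde b)p\langle\tilde a\rangle$ then $\sigma=p^{\mathrm O},\sigma'$; (2) if $\mu=p(\tilde a)$ then $\sigma=p^{\mathrm I},\sigma'$; (3) if $\mu=(\nu\tilde c,p)a\langle\tilde b,p\rangle$ then $\sigma'=p^{\mathrm I},\sigma$; (4) if $\mu=(\nu\tilde c)a\langle\tilde b,p\rangle$ ($p$ not extruded) then $\sigma=p^{\mathrm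 O},\sigma'$; (5) if $\mu=a(\tilde b,p)$ then $\sigma'=p^{\mathrm O},\sigma$; (6) if $\mu=\tau$, then $\sigma'=\sigma''$ when $\sigma=p^{\mathrm O},p^{\mathrm I},\sigma''$ and $p\notin\mathrm{fn}(P')$, and $\sigma'=\sigma$ otherwise. -}

module Defs where

-- Scope-safe de Bruijn syntax: processes are indexed by the list of sorts
-- of their free names, so every process is well-sorted by construction.

open import Data.Nat using (ℕ; zero; suc; _+_; _≤_)
open import Data.List using (List; []; _∷_; _++_; length; _∷ʳ_; map)
open import Data.List.Relation.Unary.All as All using (All; []; _∷_)
open import Data.List.Relation.Unary.Any using (Any)
open import Data.List.Relation.Unary.Linked using (Linked)
open import Data.List.Relation.Unary.Unique.Propositional using (Unique)
open import Data.List.Membership.Propositional using (_∈_)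
open import Data.Product using (Σ; ∃; ∃₂; _×_; _,_; proj₁; proj₂)
open import Data.Sum using (_⊎_; inj₁; inj₂)
open import Data.Empty using (⊥)
open import Relation.Nullary using (¬_)
open import Relation.Binary.PropositionalEquality using (_≡_; _≢_)

-- kinds of names: output-controlled, input-controlled, continuation
data Kind : Set where
  oc ic co : Kind

record Sorting : Set₁ where
  field
    Sort : Set
    kind : Sort → Kind
    obj  : Sort → List Sort
    obj-oc : ∀ s → kind s ≡ oc →
      ∃₂ λ ts t → obj s ≡ ts ++ t ∷ [] × kind t ≡ co × All (λ t′ → kind t′ ≢ co) ts
    obj-other : ∀ s → kind s ≢ oc → All (λ t → kind t ≢ co) (obj s)

data _∋_ {A : Set} : List A → A → Set where
  here  : ∀ {x xs} → (x ∷ xs) ∋ x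
  there : ∀ {x y xs} → xs ∋ x → (y ∷ xs) ∋ x

lookupAll : ∀ {A : Set} {P : A → Set} {xs x} → All P xs → xs ∋ x → P x
lookupAll (p ∷ ps) here = p
lookupAll (p ∷ ps) (there i) = lookupAll ps i

module Pi (𝒮 : Sorting) where
  open Sorting 𝒮

  Ctx : Set
  Ctx = List Sort

  Ren : Ctx → Ctx → Set
  Ren Γ Δ = ∀ {t} → Γ ∋ t → Δ ∋ t

  ext : ∀ {Γ Δ t} → Ren Γ Δ → Ren (t ∷ Γ) (t ∷ Δ)
  ext ρ here = here
  ext ρ (there v) = there (ρ v)

  extN : ∀ {Γ Δ} ss → Ren Γ Δ → Ren (ss ++ Γ) (ss ++ Δ)
  extN [] ρ = ρ
  extN (s ∷ ss) ρ = ext (extN ss ρ)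

  wkIn : ∀ {Γ} ss → Ren Γ (ss ++ Γ)
  wkIn [] v = v
  wkIn (s ∷ ss) v = there (wkIn ss v)

  bnd : ∀ {Γ ss : Ctx} {t} → ss ∋ t → (ss ++ Γ) ∋ t
  bnd here = here
  bnd (there w) = there (bnd w)

  Args : Ctx → List Sort → Set
  Args Γ ss = All (Γ ∋_) ss

  renA : ∀ {Γ Δ ss} → Ren Γ Δ → Args Γ ss → Args Δ ss
  renA ρ = All.map ρ

  inst : ∀ {Γ ss} → Args Γ ss → Ren (ss ++ Γ) Γ
  inst [] v = v
  inst (b ∷ bs) here = b
  inst (b ∷ bs) (there v) = inst bs v

  -- contexts extended by extruded names (reverse append)
  _⊕_ : Ctx → Ctx → Ctx
  [] ⊕ Γ = Γ
  (c ∷ cs) ⊕ Γ = cs ⊕ (c ∷ Γ)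

  ⊕-ext : ∀ {Γ Δ} cs → Ren Γ Δ → Ren (cs ⊕ Γ) (cs ⊕ Δ)
  ⊕-ext [] ρ = ρ
  ⊕-ext (c ∷ cs) ρ = ⊕-ext cs (ext ρ)

  wkOut : ∀ {Γ} cs → Ren Γ (cs ⊕ Γ)
  wkOut [] v = v
  wkOut (c ∷ cs) v = wkOut cs (there v)

  exch : ∀ {Γ s t} → Ren (s ∷ t ∷ Γ) (t ∷ s ∷ Γ)
  exch here = there here
  exch (there here) = here
  exch (there (there v)) = there (there v)

  swapOut : ∀ {Γ t} cs → Ren (cs ⊕ (t ∷ Γ)) (t ∷ (cs ⊕ Γ))
  swapOut [] v = v
  swapOut {Γ} {t} (c ∷ cs) v = swapOut {c ∷ Γ} {t} cs (⊕-ext cs exch v)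

  -- syntax:  P ::= a<b> | !a(b).P | P|Q | (nu a)P | G
  --          G ::= 0 | a(b).P | tau.P | [a=b]G | G+G

  data Proc (Γ : Ctx) : Set
  data Guard (Γ : Ctx) : Set

  data Proc Γ where
    out : ∀ {s} → Γ ∋ s → Args Γ (obj s) → Proc Γ
    rep : ∀ {s} → Γ ∋ s → Proc (obj s ++ Γ) → Proc Γ
    _∣_ : Proc Γ → Proc Γ → Proc Γ
    ν   : ∀ t → Proc (t ∷ Γ) → Proc Γ
    grd : Guard Γ → Proc Γ

  data Guard Γ where
    nil   : Guard Γ
    inp   : ∀ {s} → Γ ∋ s → Proc (obj s ++ Γ) → Guard Γ
    tau   : Proc Γ → Guard Γ
    match : ∀ {s} → kind s ≢ co → Γ ∋ s → Γ ∋ s → Guard Γ → Guard Γ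
    _⊞_   : Guard Γ → Guard Γ → Guard Γ

  renP : ∀ {Γ Δ} → Ren Γ Δ → Proc Γ → Proc Δ
  renG : ∀ {Γ Δ} → Ren Γ Δ → Guard Γ → Guard Δ
  renP ρ (out a b) = out (ρ a) (renA ρ b)
  renP ρ (rep {s} a P) = rep (ρ a) (renP (extN (obj s) ρ) P)
  renP ρ (P ∣ Q) = renP ρ P ∣ renP ρ Q
  renP ρ (ν t P) = ν t (renP (ext ρ) P)
  renP ρ (grd G) = grd (renG ρ G)
  renG ρ nil = nil
  renG ρ (inp {s} a P) = inp (ρ a) (renP (extN (obj s) ρ) P)
  renG ρ (tau P) = tau (renP ρ P)
  renG ρ (match n a b G) = match n (ρ a) (ρ b) (renG ρ G)
  renG ρ (G ⊞ H) = renG ρ G ⊞ renG ρ H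

  νs : ∀ {Γ} cs → Proc (cs ⊕ Γ) → Proc Γ
  νs [] P = P
  νs (c ∷ cs) P = ν c (νs cs P)

  Name : Ctx → Set
  Name Γ = Σ Sort (Γ ∋_)

  _≈ₙ_ : ∀ {Γ s t} → Γ ∋ s → Γ ∋ t → Set
  _≈ₙ_ {Γ} {s} {t} v w = _≡_ {A = Name Γ} (s , v) (t , w)

  ArgOcc : ∀ {Γ t ss} → Γ ∋ t → Args Γ ss → Set
  ArgOcc v [] = ⊥
  ArgOcc v (w ∷ ws) = v ≈ₙ w ⊎ ArgOcc v ws

  data FrP : ∀ {Γ t} → Γ ∋ t → Proc Γ → Set
  data FrG : ∀ {Γ t} → Γ ∋ t → Guard Γ → Set

  data FrP where
    outS : ∀ {Γ t s} {v : Γ ∋ t} {a : Γ ∋ s} {b} → v ≈ₙ a → FrP v (out a b)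
    outO : ∀ {Γ t s} {v : Γ ∋ t} {a : Γ ∋ s} {b} → ArgOcc v b → FrP v (out a b)
    repS : ∀ {Γ t s} {v : Γ ∋ t} {a : Γ ∋ s} {P} → v ≈ₙ a → FrP v (rep a P)
    repB : ∀ {Γ t s} {v : Γ ∋ t} {a : Γ ∋ s} {P} → FrP (wkIn (obj s) v) P → FrP v (rep a P)
    parL : ∀ {Γ t} {v : Γ ∋ t} {P Q} → FrP v P → FrP v (P ∣ Q)
    parR : ∀ {Γ t} {v : Γ ∋ t} {P Q} → FrP v Q → FrP v (P ∣ Q)
    res  : ∀ {Γ t u} {v : Γ ∋ t} {P} → FrP (there v) P → FrP v (ν u P)
    grd  : ∀ {Γ t} {v : Γ ∋ t} {G} → FrG v G → FrP v (grd G)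

  data FrG where
    inS : ∀ {Γ t s} {v : Γ ∋ t} {a : Γ ∋ s} {P} → v ≈ₙ a → FrG v (inp a P)
    inB : ∀ {Γ t s} {v : Γ ∋ t} {a : Γ ∋ s} {P} → FrP (wkIn (obj s) v) P → FrG v (inp a P)
    tauB : ∀ {Γ t} {v : Γ ∋ t} {P} → FrP v P → FrG v (tau P)
    matchL : ∀ {Γ t s} {v : Γ ∋ t} {n} {a b : Γ ∋ s} {G} → v ≈ₙ a → FrG v (match n a b G)
    matchR : ∀ {Γ t s} {v : Γ ∋ t} {n} {a b : Γ ∋ s} {G} → v ≈ₙ b → FrG v (match n a b G)
    matchB : ∀ {Γ t s} {v : Γ ∋ t} {n} {a b : Γ ∋ s} {G} → FrG v G → FrG v (match n a b G)
    sumL : ∀ {Γ t} {v : Γ ∋ t} {G H} → FrG v G → FrG v (G ⊞ H)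
    sumR : ∀ {Γ t} {v : Γ ∋ t} {G H} → FrG v H → FrG v (G ⊞ H)

  -- actions: tau, early input a(b), output (nu cs) a<b>

  data Act (Γ : Ctx) : Set where
    τ    : Act Γ
    inA  : ∀ {s} → Γ ∋ s → Args Γ (obj s) → Act Γ
    outA : ∀ cs {s} → Γ ∋ s → Args (cs ⊕ Γ) (obj s) → Act Γ

  tgt : ∀ {Γ} → Act Γ → Ctx
  tgt {Γ} τ = Γ
  tgt {Γ} (inA _ _) = Γ
  tgt {Γ} (outA cs _ _) = cs ⊕ Γ

  wkP : ∀ {Γ} cs → Proc Γ → Proc (cs ⊕ Γ)
  wkP [] Q = Q
  wkP (c ∷ cs) Q = renP (wkOut (c ∷ cs)) Q

  wkTgt : ∀ {Γ} (μ : Act Γ) → Proc Γ → Proc (tgt μ)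
  wkTgt τ Q = Q
  wkTgt (inA _ _) Q = Q
  wkTgt (outA cs _ _) Q = wkP cs Q

  -- an action of Γ seen under a further restriction (the restricted name
  -- does not occur in it)
  wkAct : ∀ {Γ t} → Act Γ → Act (t ∷ Γ)
  wkAct τ = τ
  wkAct (inA a b) = inA (there a) (renA (λ v → there v) b)
  wkAct (outA cs a b) = outA cs (there a) (renA (⊕-ext cs (λ v → there v)) b)

  resTgt : ∀ {Γ t} (μ : Act Γ) → Proc (tgt (wkAct {Γ} {t} μ)) → Proc (t ∷ tgt μ)
  resTgt τ P = P
  resTgt (inA _ _) P = P
  resTgt (outA cs _ _) P = renP (swapOut cs) P

  FnAct : ∀ {Γ t} → Γ ∋ t → Act Γ → Set
  FnAct p τ = ⊥
  FnAct p (inA a b) = p ≈ₙ a ⊎ ArgOcc p b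
  FnAct p (outA cs a b) = p ≈ₙ a ⊎ ArgOcc (wkOut cs p) b

  Subj : ∀ {Γ t} → Γ ∋ t → Act Γ → Set
  Subj p τ = ⊥
  Subj p (inA a _) = p ≈ₙ a
  Subj p (outA _ a _) = p ≈ₙ a

  data _—[_]→_ : ∀ {Γ} → Proc Γ → (μ : Act Γ) → Proc (tgt μ) → Set
  data _—G[_]→_ : ∀ {Γ} → Guard Γ → (μ : Act Γ) → Proc (tgt μ) → Set

  data _—[_]→_ where
    tOut : ∀ {Γ s} {a : Γ ∋ s} {b} → out a b —[ outA [] a b ]→ grd nil
    tRep : ∀ {Γ s} {a : Γ ∋ s} {P b} → rep a P —[ inA a b ]→ (renP (inst b) P ∣ rep a P)
    tGrd : ∀ {Γ} {G : Guard Γ} {μ P′} → G —G[ μ ]→ P′ → grd G —[ μ ]→ P′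
    tParL : ∀ {Γ} {P Q : Proc Γ} {μ P′} → P —[ μ ]→ P′ →
      (P ∣ Q) —[ μ ]→ (P′ ∣ wkTgt μ Q)
    tParR : ∀ {Γ} {P Q : Proc Γ} {μ Q′} → Q —[ μ ]→ Q′ →
      (P ∣ Q) —[ μ ]→ (wkTgt μ P ∣ Q′)
    -- communication / close (cs = [] : plain communication)
    tComL : ∀ {Γ cs s} {a : Γ ∋ s} {b} {P Q : Proc Γ} {P′ Q′} →
      P —[ outA cs a b ]→ P′ → wkP cs Q —[ inA (wkOut cs a) b ]→ Q′ →
      (P ∣ Q) —[ τ ]→ νs cs (P′ ∣ Q′)
    tComR : ∀ {Γ cs s} {a : Γ ∋ s} {b} {P Q : Proc Γ} {P′ Q′} →
      Q —[ outA cs a b ]→ Q′ → wkP cs P —[ inA (wkOut cs a) b ]→ P′ →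
      (P ∣ Q) —[ τ ]→ νs cs (P′ ∣ Q′)
    tRes : ∀ {Γ t} {P : Proc (t ∷ Γ)} {μ : Act Γ} {P′} → P —[ wkAct μ ]→ P′ →
      ν t P —[ μ ]→ ν t (resTgt μ P′)
    tOpen : ∀ {Γ t cs s} {a : Γ ∋ s} {P : Proc (t ∷ Γ)} {b P′} →
      P —[ outA cs (there a) b ]→ P′ → ArgOcc (wkOut cs (here {x = t} {xs = Γ})) b →
      ν t P —[ outA (t ∷ cs) a b ]→ P′

  data _—G[_]→_ where
    tInp : ∀ {Γ s} {a : Γ ∋ s} {P b} → inp a P —G[ inA a b ]→ renP (inst b) P
    tTau : ∀ {Γ} {P : Proc Γ} → tau P —G[ τ ]→ P
    tMatch : ∀ {Γ s} {n} {a : Γ ∋ s} {G μ P′} → G —G[ μ ]→ P′ → match n a a G —G[ μ ]→ P′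
    tSumL : ∀ {Γ} {G H : Guard Γ} {μ P′} → G —G[ μ ]→ P′ → (G ⊞ H) —G[ μ ]→ P′
    tSumR : ∀ {Γ} {G H : Guard Γ} {μ P′} → H —G[ μ ]→ P′ → (G ⊞ H) —G[ μ ]→ P′

  -- sequentiality typing  ⊢_η P  (continuation names count as output-controlled)

  data ⊢S[_]_ : ∀ {Γ} → ℕ → Proc Γ → Set
  data ⊢SG[_]_ : ∀ {Γ} → ℕ → Guard Γ → Set

  data ⊢S[_]_ where
    sOutO : ∀ {Γ s} {a : Γ ∋ s} {b} → kind s ≢ ic → ⊢S[ 1 ] out a b
    sOutI : ∀ {Γ s} {a : Γ ∋ s} {b} → kind s ≡ ic → ⊢S[ 0 ] out a b
    sRep  : ∀ {Γ s} {a : Γ ∋ s} {P} → kind s ≢ ic → ⊢S[ 1 ] P → ⊢S[ 0 ] rep a P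
    sPar  : ∀ {Γ η₁ η₂} {P Q : Proc Γ} → ⊢S[ η₁ ] P → ⊢S[ η₂ ] Q → η₁ + η₂ ≤ 1 →
      ⊢S[ η₁ + η₂ ] (P ∣ Q)
    sRes  : ∀ {Γ t η} {P : Proc (t ∷ Γ)} → ⊢S[ η ] P → ⊢S[ η ] ν t P
    sGrd  : ∀ {Γ η} {G : Guard Γ} → ⊢SG[ η ] G → ⊢S[ η ] grd G

  data ⊢SG[_]_ where
    sNil   : ∀ {Γ} → ⊢SG[ 0 ] (nil {Γ})
    sInI   : ∀ {Γ s} {a : Γ ∋ s} {P} → kind s ≡ ic → ⊢S[ 1 ] P → ⊢SG[ 1 ] inp a P
    sInO   : ∀ {Γ s} {a : Γ ∋ s} {P} → kind s ≢ ic → ⊢S[ 1 ] P → ⊢SG[ 0 ] inp a P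
    sTau   : ∀ {Γ η} {P : Proc Γ} → ⊢S[ η ] P → ⊢SG[ η ] tau P
    sMatch : ∀ {Γ s} {n} {a b : Γ ∋ s} {G} → ⊢SG[ 0 ] G → ⊢SG[ 0 ] match n a b G
    sSum   : ∀ {Γ η} {G H : Guard Γ} → ⊢SG[ η ] G → ⊢SG[ η ] H → ⊢SG[ η ] (G ⊞ H)

  Allowed : ∀ {Γ} → Act Γ → Set
  Allowed τ = ⊥
  Allowed (inA {s} _ _) = kind s ≡ ic
  Allowed (outA _ {s} _ _) = kind s ≢ ic

  record _⊢S_—[_]→_ {Γ} (η : ℕ) (P : Proc Γ) (μ : Act Γ) (P′ : Proc (tgt μ)) : Set where
    field
      typed   : ⊢S[ η ] P
      trans   : P —[ μ ]→ P′
      allowed : η ≡ 0 ⊎ μ ≡ τ ⊎ (η ≡ 1 × Allowed μ)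

  data Tag : Set where
    O I : Tag

  Stack : Ctx → Set
  Stack Γ = List (Tag × Name Γ)

  renS : ∀ {Γ Δ} → Ren Γ Δ → Stack Γ → Stack Δ
  renS ρ = map (λ e → proj₁ e , (proj₁ (proj₂ e) , ρ (proj₂ (proj₂ e))))

  _∈S_ : ∀ {Γ} → Name Γ → Stack Γ → Set
  p ∈S σ = Any (λ e → proj₂ e ≡ p) σ

  seq : ∀ {Γ} → Stack Γ → ℕ
  seq [] = 0
  seq ((O , _) ∷ _) = 1
  seq ((I , _) ∷ _) = 0

  EndsWith : ∀ {Γ} → Tag → Stack Γ → Set
  EndsWith g σ = ∃₂ λ σ₀ p → σ ≡ σ₀ ∷ʳ (g , p)

  record IsStack {Γ} (σ : Stack Γ) : Set where
    field
      alternating  : Linked (λ e e′ → proj₁ e ≢ proj₁ e′) σ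
      endsOut      : σ ≡ [] ⊎ EndsWith O σ
      oncePerTag   : Unique σ
      adjacent     : ∀ p → (O , p) ∈ σ → (I , p) ∈ σ →
                       ∃₂ λ α β → σ ≡ α ++ (O , p) ∷ (I , p) ∷ β
      continuation : All (λ e → kind (proj₁ (proj₂ e)) ≡ co) σ

  data Interleave {Γ} : Stack Γ → Stack Γ → Stack Γ → Set where
    iNil : Interleave [] [] []
    iR : ∀ {t σ₁ σ₂ σ₃} → Interleave σ₁ σ₂ σ₃ → Interleave (t ∷ σ₁) σ₂ (t ∷ σ₃)
    iL : ∀ {t σ₁ σ₂ σ₃} → Interleave σ₁ σ₂ σ₃ → Interleave (t ∷ σ₁) (t ∷ σ₂) σ₃

  _∈_⋈_ : ∀ {Γ} → Stack Γ → Stack Γ → Stack Γ → Set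
  σ₁ ∈ σ₂ ⋈ σ₃ = IsStack σ₁ × Interleave σ₁ σ₂ σ₃

  data ⊢W[_]_ : ∀ {Γ} → Stack Γ → Proc Γ → Set
  data ⊢WG[_]_ : ∀ {Γ} → Stack Γ → Guard Γ → Set

  data ⊢W[_]_ where
    wOutP : ∀ {Γ s} {a : Γ ∋ s} {b} → kind s ≡ co → ⊢W[ (O , (s , a)) ∷ [] ] out a b
    wOutX : ∀ {Γ s t} {a : Γ ∋ s} {b} (w : obj s ∋ t) → kind s ≡ oc → kind t ≡ co →
      ⊢W[ (O , (t , lookupAll b w)) ∷ [] ] out a b
    wOutU : ∀ {Γ s} {a : Γ ∋ s} {b} → kind s ≡ ic → ⊢W[ [] ] out a b
    wRep  : ∀ {Γ s t} {a : Γ ∋ s} {P} (w : obj s ∋ t) → kind s ≡ oc → kind t ≡ co →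
      ⊢W[ (O , (t , bnd {Γ} w)) ∷ [] ] P → ⊢W[ [] ] rep a P
    wPar  : ∀ {Γ} {σ σ₁ σ₂ : Stack Γ} {P Q} → ⊢W[ σ₁ ] P → ⊢W[ σ₂ ] Q → σ ∈ σ₁ ⋈ σ₂ →
      ⊢W[ σ ] (P ∣ Q)
    wResC : ∀ {Γ t} {P : Proc (t ∷ Γ)} (ξ σ′ : Stack Γ) → kind t ≡ co →
      (ξ ≡ [] ⊎ EndsWith I ξ) →
      ⊢W[ renS there ξ ++ (O , (t , here)) ∷ (I , (t , here)) ∷ renS there σ′ ] P →
      ⊢W[ ξ ++ σ′ ] ν t P
    -- (nu p)P with p not in the stack, and (nu a)P
    wRes  : ∀ {Γ t} {σ : Stack Γ} {P : Proc (t ∷ Γ)} → ⊢W[ renS there σ ] P → ⊢W[ σ ] ν t P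
    wGrd  : ∀ {Γ} {σ : Stack Γ} {G} → ⊢WG[ σ ] G → ⊢W[ σ ] grd G

  data ⊢WG[_]_ where
    wInC : ∀ {Γ s} {a : Γ ∋ s} {P} (p : Name Γ) → kind s ≡ co → kind (proj₁ p) ≡ co →
      _≢_ {A = Name Γ} (s , a) p →
      ⊢W[ (O , (proj₁ p , wkIn (obj s) (proj₂ p))) ∷ [] ] P →
      ⊢WG[ (I , (s , a)) ∷ (O , p) ∷ [] ] inp a P
    wInX : ∀ {Γ s t} {a : Γ ∋ s} {P} (w : obj s ∋ t) → kind s ≡ oc → kind t ≡ co →
      ⊢W[ (O , (t , bnd {Γ} w)) ∷ [] ] P → ⊢WG[ [] ] inp a P
    wInU : ∀ {Γ s} {a : Γ ∋ s} {P} (p : Name Γ) → kind s ≡ ic → kind (proj₁ p) ≡ co →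
      ⊢W[ (O , (proj₁ p , wkIn (obj s) (proj₂ p))) ∷ [] ] P →
      ⊢WG[ (O , p) ∷ [] ] inp a P
    wNil : ∀ {Γ} → ⊢WG[ [] ] (nil {Γ})
    wMatch : ∀ {Γ s} {n} {a b : Γ ∋ s} {G} → ⊢WG[ [] ] G → ⊢WG[ [] ] match n a b G
    wTau : ∀ {Γ} {σ : Stack Γ} {P} → ⊢W[ σ ] P → length σ ≤ 1 → ⊢WG[ σ ] tau P
    wSum : ∀ {Γ} {σ : Stack Γ} {G H} → ⊢WG[ σ ] G → ⊢WG[ σ ] H → length σ ≤ 1 →
      ⊢WG[ σ ] (G ⊞ H)

  record _⊢W_—[_]→_ {Γ} (σ : Stack Γ) (P : Proc Γ) (μ : Act Γ) (P′ : Proc (tgt μ)) : Set where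
    field
      typed    : ⊢W[ σ ] P
      seqTrans : seq σ ⊢S P —[ μ ]→ P′
      contCond : ∀ (p : Name Γ) → kind (proj₁ p) ≡ co → FnAct (proj₂ p) μ → p ∈S σ →
        ∃₂ λ g σ₁ → σ ≡ (g , p) ∷ σ₁ × (p ∈S σ₁ → ¬ Subj (proj₂ p) μ)

  data Upd {Γ} (σ : Stack Γ) : (μ : Act Γ) → Proc (tgt μ) → Stack (tgt μ) → Set where
    uOutC : ∀ {cs s} {a : Γ ∋ s} {b P′} {ρ : Stack Γ} → kind s ≡ co →
      σ ≡ (O , (s , a)) ∷ ρ → Upd σ (outA cs a b) P′ (renS (wkOut cs) ρ)
    -- (3) output at an output-controlled name, continuation p extruded
    uOutXe : ∀ {cs s t} {a : Γ ∋ s} {b P′} (w : obj s ∋ t) → kind s ≡ oc → kind t ≡ co →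
      (¬ ∃ λ (q : Γ ∋ t) → lookupAll b w ≡ wkOut cs q) →
      Upd σ (outA cs a b) P′ ((I , (t , lookupAll b w)) ∷ renS (wkOut cs) σ)
    -- (4) output at an output-controlled name, continuation p not extruded
    uOutXn : ∀ {cs s t} {a : Γ ∋ s} {b P′} {ρ : Stack Γ} (w : obj s ∋ t) →
      kind s ≡ oc → kind t ≡ co → (q : Γ ∋ t) → lookupAll b w ≡ wkOut cs q →
      σ ≡ (O , (t , q)) ∷ ρ → Upd σ (outA cs a b) P′ (renS (wkOut cs) ρ)
    uOutU : ∀ {cs s} {a : Γ ∋ s} {b P′} → kind s ≡ ic →
      Upd σ (outA cs a b) P′ (renS (wkOut cs) σ)
    uInC : ∀ {s} {a : Γ ∋ s} {b P′} {ρ : Stack Γ} → kind s ≡ co →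
      σ ≡ (I , (s , a)) ∷ ρ → Upd σ (inA a b) P′ ρ
    uInX : ∀ {s t} {a : Γ ∋ s} {b P′} (w : obj s ∋ t) → kind s ≡ oc → kind t ≡ co →
      Upd σ (inA a b) P′ ((O , (t , lookupAll b w)) ∷ σ)
    uInU : ∀ {s} {a : Γ ∋ s} {b P′} → kind s ≡ ic → Upd σ (inA a b) P′ σ
    uTauPop : ∀ {P′} {p : Name Γ} {ρ : Stack Γ} → σ ≡ (O , p) ∷ (I , p) ∷ ρ →
      ¬ FrP (proj₂ p) P′ → Upd σ τ P′ ρ
    uTauKeep : ∀ {P′} →
      ¬ (∃₂ λ (p : Name Γ) ρ → σ ≡ (O , p) ∷ (I , p) ∷ ρ × ¬ FrP (proj₂ p) P′) →
      Upd σ τ P′ σ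

  record ⟨_⨾_⟩—[_]→⟨_⨾_⟩ {Γ} (σ : Stack Γ) (P : Proc Γ) (μ : Act Γ)
                          (σ′ : Stack (tgt μ)) (P′ : Proc (tgt μ)) : Set where
    field
      typedTrans : σ ⊢W P —[ μ ]→ P′
      update     : Upd σ μ P′ σ′

{-# OPTIONS --safe #-}
module Submission where

-- Two invariants drive the argument. A well-typed stack alternates and ends with an output tag,
-- so its head tag, which is the sequentiality level of the process, is the parity of its length;
-- as the lengths of interleaved stacks add up, the levels of the components of a parallel
-- composition decide which of them owns the top of the stack. And typing is stable under
-- renamings injective on the stack, which covers the instantiation of inputs, weakening by
-- extruded names and the rebinding of restrictions. A communication on a continuation p pops
-- p^O on the sender's side and p^I on the receiver's: this is the pair a silent step removes.
-- One that extrudes a continuation p pushes p^I and p^O instead, and the restriction closing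
-- the communication binds that pair again.

open import Defs
open import Data.Nat using (ℕ; zero; suc; _+_; _≤_; s≤s; s≤s⁻¹)
open import Data.Nat.Properties using (+-comm; +-suc; m+n≡0⇒m≡0; m+n≡0⇒n≡0; n≤0⇒n≡0; 1+n≢0)
open import Data.List using (List; []; _∷_; _++_; length; _∷ʳ_; map)
open import Data.List.Properties using (∷-injectiveʳ; ∷ʳ-injectiveʳ; map-∘; map-cong; map-id; map-++; length-map)
open import Data.List.Relation.Unary.All as All using (All; []; _∷_)
open import Data.List.Relation.Unary.All.Properties as Allₚ using (All¬⇒¬Any; ¬Any⇒All¬)
open import Data.List.Relation.Unary.Any as Any using (here; there)
import Data.List.Relation.Unary.Any.Properties as Anyₚ
open import Data.List.Relation.Unary.Linked using (Linked; []; [-]; _∷_)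
import Data.List.Relation.Unary.Linked.Properties as Linkedₚ
open import Data.List.Relation.Unary.AllPairs using ([]; _∷_)
open import Data.List.Relation.Unary.Unique.Propositional using (Unique)
open import Data.List.Membership.Propositional using (_∈_; find)
open import Data.List.Membership.Propositional.Properties using (∈-++⁺ˡ; ∈-++⁺ʳ; ∈-++⁻; ∈-map⁺; ∈-map⁻)
open import Data.Product using (Σ; ∃; ∃₂; _×_; _,_; proj₁; proj₂)
open import Data.Sum using (_⊎_; inj₁; inj₂; map₁; map₂)
open import Data.Empty using (⊥; ⊥-elim)
open import Relation.Nullary using (¬_; Dec; yes; no)
open import Function using (_∘_)
open import Function.Definitions using (Injective)
open import Relation.Binary.PropositionalEquality

module SubjectReduction (𝒮 : Sorting) where
  open Sorting 𝒮
  open Pi 𝒮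

  tags : ∀ {Γ} → Stack Γ → List Tag
  tags = map proj₁

  data AltO : List Tag → Set
  data AltI : List Tag → Set

  data AltO where
    O∷[] : AltO (O ∷ [])
    O∷_  : ∀ {l} → AltI l → AltO (O ∷ l)

  data AltI where
    I∷_ : ∀ {l} → AltO l → AltI (I ∷ l)

  data Alternating : List Tag → Set where
    empty : Alternating []
    alO : ∀ {l} → AltO l → Alternating l
    alI : ∀ {l} → AltI l → Alternating l

  seqTag : List Tag → ℕ
  seqTag [] = 0
  seqTag (O ∷ _) = 1
  seqTag (I ∷ _) = 0

  seq≡seqTag : ∀ {Γ} (σ : Stack Γ) → seq σ ≡ seqTag (tags σ)
  seq≡seqTag [] = refl
  seq≡seqTag ((O , _) ∷ _) = refl
  seq≡seqTag ((I , _) ∷ _) = refl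

  seqTag-AltO : ∀ {l} → AltO l → seqTag l ≡ 1
  seqTag-AltO O∷[] = refl
  seqTag-AltO (O∷ _) = refl

  seqTag-cong-head : ∀ g l l′ → seqTag (g ∷ l) ≡ seqTag (g ∷ l′)
  seqTag-cong-head O l l′ = refl
  seqTag-cong-head I l l′ = refl

  parity : ℕ → ℕ
  parity zero = 0
  parity (suc zero) = 1
  parity (suc (suc n)) = parity n

  parity-+-evenˡ : ∀ m n → parity m ≡ 0 → parity (m + n) ≡ parity n
  parity-+-evenˡ zero n _ = refl
  parity-+-evenˡ (suc (suc m)) n e = parity-+-evenˡ m n e

  parity-+-evenʳ : ∀ m n → parity n ≡ 0 → parity (m + n) ≡ parity m
  parity-+-evenʳ m n e rewrite +-comm m n = parity-+-evenˡ n m e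

  parity-AltO : ∀ {l} → AltO l → parity (length l) ≡ 1
  parity-AltI : ∀ {l} → AltI l → parity (length l) ≡ 0
  parity-AltO O∷[] = refl
  parity-AltO (O∷ I∷ a) = parity-AltO a
  parity-AltI (I∷ O∷[]) = refl
  parity-AltI (I∷ O∷ a) = parity-AltI a

  seqTag≡parity : ∀ {l} → Alternating l → seqTag l ≡ parity (length l)
  seqTag≡parity empty = refl
  seqTag≡parity (alO O∷[]) = refl
  seqTag≡parity (alO (O∷ I∷ a)) = sym (parity-AltO a)
  seqTag≡parity (alI (I∷ O∷[])) = refl
  seqTag≡parity (alI (I∷ O∷ a)) = sym (parity-AltI a)

  seqTag≡parity-length : ∀ {Γ} (σ : Stack Γ) → Alternating (tags σ) → seqTag (tags σ) ≡ parity (length σ)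
  seqTag≡parity-length σ a = trans (seqTag≡parity a) (cong parity (length-map proj₁ σ))

  Alternating-tail : ∀ {g l} → Alternating (g ∷ l) → Alternating l
  Alternating-tail (alO O∷[]) = empty
  Alternating-tail (alO (O∷ a)) = alI a
  Alternating-tail (alI (I∷ a)) = alO a

  Alternating-consO : ∀ {l} → Alternating l → seqTag l ≡ 0 → Alternating (O ∷ l)
  Alternating-consO empty _ = alO O∷[]
  Alternating-consO (alO O∷[]) ()
  Alternating-consO (alO (O∷ _)) ()
  Alternating-consO (alI a) _ = alO (O∷ a)

  Alternating-consI : ∀ {l} → Alternating l → seqTag l ≡ 1 → Alternating (I ∷ l)
  Alternating-consI empty ()
  Alternating-consI (alO a) _ = alI (I∷ a)
  Alternating-consI (alI (I∷ _)) ()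

  AltO-cut : ∀ A B → AltO ((A ∷ʳ I) ++ O ∷ I ∷ B) → AltO ((A ∷ʳ I) ++ B)
  AltI-cut : ∀ A B → AltI ((A ∷ʳ I) ++ O ∷ I ∷ B) → AltI ((A ∷ʳ I) ++ B)
  AltO-cut [] B ()
  AltO-cut (O ∷ []) B (O∷ a) = O∷ AltI-cut [] B a
  AltO-cut (O ∷ A@(_ ∷ _)) B (O∷ a) = O∷ AltI-cut A B a
  AltO-cut (I ∷ A) B ()
  AltI-cut [] B (I∷ O∷ I∷ a) = I∷ a
  AltI-cut (O ∷ A) B ()
  AltI-cut (I ∷ A) B (I∷ a) = I∷ AltO-cut A B a

  Alternating-cut : ∀ A B → (A ≡ [] ⊎ ∃ λ A₀ → A ≡ A₀ ∷ʳ I) →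
    Alternating (A ++ O ∷ I ∷ B) → Alternating (A ++ B)
  Alternating-cut .[] B (inj₁ refl) (alO (O∷ I∷ a)) = alO a
  Alternating-cut .[] B (inj₁ refl) (alI ())
  Alternating-cut .(A₀ ∷ʳ I) B (inj₂ (A₀ , refl)) = cut A₀
    where
    cut : ∀ A₀ → Alternating ((A₀ ∷ʳ I) ++ O ∷ I ∷ B) → Alternating ((A₀ ∷ʳ I) ++ B)
    cut [] (alO a) = alO (AltO-cut [] B a)
    cut [] (alI a) = alI (AltI-cut [] B a)
    cut (g ∷ A₀) (alO a) = alO (AltO-cut (g ∷ A₀) B a)
    cut (g ∷ A₀) (alI a) = alI (AltI-cut (g ∷ A₀) B a)

  Alternating-cons : ∀ {g g′ l} → g ≢ g′ → Alternating (g′ ∷ l) → Alternating (g ∷ g′ ∷ l)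
  Alternating-cons {O} ne (alO O∷[]) = ⊥-elim (ne refl)
  Alternating-cons {O} ne (alO (O∷ _)) = ⊥-elim (ne refl)
  Alternating-cons {O} ne (alI a) = alO (O∷ a)
  Alternating-cons {I} ne (alO a) = alI (I∷ a)
  Alternating-cons {I} ne (alI (I∷ _)) = ⊥-elim (ne refl)

  EndsInO : List Tag → Set
  EndsInO l = l ≡ [] ⊎ ∃ λ l₀ → l ≡ l₀ ∷ʳ O

  linked⇒Alternating : ∀ {l} → Linked _≢_ l → EndsInO l → Alternating l
  linked⇒Alternating [] _ = empty
  linked⇒Alternating [-] (inj₂ (l₀ , eq)) with ∷ʳ-injectiveʳ [] l₀ eq
  ... | refl = alO O∷[]
  linked⇒Alternating (ne ∷ lk) (inj₂ ([] , ()))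
  linked⇒Alternating (ne ∷ lk) (inj₂ (_ ∷ l₀ , eq)) =
    Alternating-cons ne (linked⇒Alternating lk (inj₂ (l₀ , ∷-injectiveʳ eq)))

  AltO⇒linked : ∀ {l} → AltO l → Linked _≢_ l
  AltI⇒linked : ∀ {l} → AltI l → Linked _≢_ l
  AltO⇒linked O∷[] = [-]
  AltO⇒linked (O∷ (I∷ a)) = (λ ()) ∷ AltI⇒linked (I∷ a)
  AltI⇒linked (I∷ O∷[]) = (λ ()) ∷ [-]
  AltI⇒linked (I∷ (O∷ a)) = (λ ()) ∷ AltO⇒linked (O∷ a)

  Alternating⇒linked : ∀ {l} → Alternating l → Linked _≢_ l
  Alternating⇒linked empty = []
  Alternating⇒linked (alO a) = AltO⇒linked a
  Alternating⇒linked (alI a) = AltI⇒linked a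

  Entry : Ctx → Set
  Entry Γ = Tag × Name Γ

  renName : ∀ {Γ Δ} → Ren Γ Δ → Name Γ → Name Δ
  renName ρ (s , v) = s , ρ v

  renEntry : ∀ {Γ Δ} → Ren Γ Δ → Entry Γ → Entry Δ
  renEntry ρ (g , n) = g , renName ρ n

  EmptyOrEndsWith : ∀ {Γ} → Tag → Stack Γ → Set
  EmptyOrEndsWith g σ = σ ≡ [] ⊎ EndsWith g σ

  EndsOut⇒EndsInO : ∀ {Γ} {σ : Stack Γ} → EmptyOrEndsWith O σ → EndsInO (tags σ)
  EndsOut⇒EndsInO (inj₁ refl) = inj₁ refl
  EndsOut⇒EndsInO (inj₂ (σ₀ , p , refl)) = inj₂ (tags σ₀ , map-++ proj₁ σ₀ _)

  Alternating⇒EndsOut : ∀ {Γ} (σ : Stack Γ) → Alternating (tags σ) → EmptyOrEndsWith O σ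
  Alternating⇒EndsOut [] _ = inj₁ refl
  Alternating⇒EndsOut ((O , n) ∷ []) _ = inj₂ ([] , n , refl)
  Alternating⇒EndsOut ((I , n) ∷ []) (alI (I∷ ()))
  Alternating⇒EndsOut (e ∷ σ@(_ ∷ _)) a with Alternating⇒EndsOut σ (Alternating-tail a)
  ... | inj₂ (σ₀ , p , eq) = inj₂ (e ∷ σ₀ , p , cong (e ∷_) eq)

  IsStack⇒Alternating : ∀ {Γ} {σ : Stack Γ} → IsStack σ → Alternating (tags σ)
  IsStack⇒Alternating s =
    linked⇒Alternating (Linkedₚ.map⁺ (IsStack.alternating s)) (EndsOut⇒EndsInO (IsStack.endsOut s))

  Adjacent : ∀ {Γ} → Stack Γ → Set
  Adjacent σ = ∀ p → (O , p) ∈ σ → (I , p) ∈ σ → ∃₂ λ α β → σ ≡ α ++ (O , p) ∷ (I , p) ∷ β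

  AllCont : ∀ {Γ} → Stack Γ → Set
  AllCont = All (λ e → kind (proj₁ (proj₂ e)) ≡ co)

  mkIsStack : ∀ {Γ} {σ : Stack Γ} → Alternating (tags σ) → Unique σ → Adjacent σ → AllCont σ →
    IsStack σ
  mkIsStack {σ = σ} a u adj k = record
    { alternating = Linkedₚ.map⁻ (Alternating⇒linked a)
    ; endsOut = Alternating⇒EndsOut σ a
    ; oncePerTag = u
    ; adjacent = adj
    ; continuation = k }

  ∈⇒∈S : ∀ {Γ} {g} {n : Name Γ} {σ} → (g , n) ∈ σ → n ∈S σ
  ∈⇒∈S = Any.map (λ eq → sym (cong proj₂ eq))

  ∈S⇒∈ : ∀ {Γ} {n : Name Γ} {σ} → n ∈S σ → ∃ λ g → (g , n) ∈ σ
  ∈S⇒∈ m with find m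
  ... | (g , _) , m′ , refl = g , m′

  tags-renS : ∀ {Γ Δ} (ρ : Ren Γ Δ) σ → tags (renS ρ σ) ≡ tags σ
  tags-renS ρ σ = sym (map-∘ σ)

  renS-∘ : ∀ {Γ Δ Θ} (ρ : Ren Δ Θ) (ρ′ : Ren Γ Δ) σ →
    renS ρ (renS ρ′ σ) ≡ renS (λ v → ρ (ρ′ v)) σ
  renS-∘ ρ ρ′ σ = sym (map-∘ σ)

  renS-cong : ∀ {Γ Δ} {ρ ρ′ : Ren Γ Δ} → (∀ {t} (v : Γ ∋ t) → ρ v ≡ ρ′ v) → ∀ σ →
    renS ρ σ ≡ renS ρ′ σ
  renS-cong h = map-cong (λ e → cong (λ v → proj₁ e , proj₁ (proj₂ e) , v) (h (proj₂ (proj₂ e))))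

  renS-id : ∀ {Γ} (σ : Stack Γ) → renS (λ v → v) σ ≡ σ
  renS-id = map-id

  renS-++ : ∀ {Γ Δ} (ρ : Ren Γ Δ) σ σ′ → renS ρ (σ ++ σ′) ≡ renS ρ σ ++ renS ρ σ′
  renS-++ ρ = map-++ (renEntry ρ)

  ∈S-renS⁺ : ∀ {Γ Δ} (ρ : Ren Γ Δ) {n : Name Γ} {σ} → n ∈S σ → renName ρ n ∈S renS ρ σ
  ∈S-renS⁺ ρ m = Anyₚ.map⁺ (Any.map (cong (renName ρ)) m)

  ∈S-renS⁻ : ∀ {Γ Δ} (ρ : Ren Γ Δ) {n′ : Name Δ} σ → n′ ∈S renS ρ σ →
    ∃ λ n → n ∈S σ × n′ ≡ renName ρ n
  ∈S-renS⁻ ρ σ m with ∈S⇒∈ m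
  ... | _ , m′ with ∈-map⁻ (renEntry ρ) m′
  ... | (g , n) , m″ , refl = n , ∈⇒∈S m″ , refl

  EmptyOrEndsWith-renS : ∀ {Γ Δ} (ρ : Ren Γ Δ) {g} {ξ} → EmptyOrEndsWith g ξ →
    EmptyOrEndsWith g (renS ρ ξ)
  EmptyOrEndsWith-renS ρ (inj₁ refl) = inj₁ refl
  EmptyOrEndsWith-renS ρ (inj₂ (ξ₀ , p , refl)) = inj₂ (renS ρ ξ₀ , renName ρ p , renS-++ ρ ξ₀ _)

  EmptyOrEndsWith-tail : ∀ {Γ} {e : Entry Γ} {ξ g} → EmptyOrEndsWith g (e ∷ ξ) →
    EmptyOrEndsWith g ξ
  EmptyOrEndsWith-tail (inj₁ ())
  EmptyOrEndsWith-tail (inj₂ ([] , p , refl)) = inj₁ refl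
  EmptyOrEndsWith-tail (inj₂ (_ ∷ ξ₀ , p , refl)) = inj₂ (ξ₀ , p , refl)

  Interleave-length : ∀ {Γ} {σ σ₁ σ₂ : Stack Γ} → Interleave σ σ₁ σ₂ →
    length σ ≡ length σ₁ + length σ₂
  Interleave-length iNil = refl
  Interleave-length {σ₁ = σ₁} (iR i) = trans (cong suc (Interleave-length i)) (sym (+-suc (length σ₁) _))
  Interleave-length (iL i) = cong suc (Interleave-length i)

  Interleave-swap : ∀ {Γ} {σ σ₁ σ₂ : Stack Γ} → Interleave σ σ₁ σ₂ → Interleave σ σ₂ σ₁
  Interleave-swap iNil = iNil
  Interleave-swap (iR i) = iL (Interleave-swap i)
  Interleave-swap (iL i) = iR (Interleave-swap i)

  Interleave-renS : ∀ {Γ Δ} (ρ : Ren Γ Δ) {σ σ₁ σ₂ : Stack Γ} → Interleave σ σ₁ σ₂ →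
    Interleave (renS ρ σ) (renS ρ σ₁) (renS ρ σ₂)
  Interleave-renS ρ iNil = iNil
  Interleave-renS ρ (iR i) = iR (Interleave-renS ρ i)
  Interleave-renS ρ (iL i) = iL (Interleave-renS ρ i)

  Interleave-∈ˡ : ∀ {Γ} {σ σ₁ σ₂ : Stack Γ} {e} → Interleave σ σ₁ σ₂ → e ∈ σ₁ → e ∈ σ
  Interleave-∈ˡ (iR i) m = there (Interleave-∈ˡ i m)
  Interleave-∈ˡ (iL i) (here p) = here p
  Interleave-∈ˡ (iL i) (there m) = there (Interleave-∈ˡ i m)

  Interleave-∈ʳ : ∀ {Γ} {σ σ₁ σ₂ : Stack Γ} {e} → Interleave σ σ₁ σ₂ → e ∈ σ₂ → e ∈ σ
  Interleave-∈ʳ i = Interleave-∈ˡ (Interleave-swap i)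

  Interleave-∈⁻ : ∀ {Γ} {σ σ₁ σ₂ : Stack Γ} {e} → Interleave σ σ₁ σ₂ → e ∈ σ → e ∈ σ₁ ⊎ e ∈ σ₂
  Interleave-∈⁻ (iR i) (here p) = inj₂ (here p)
  Interleave-∈⁻ (iR i) (there m) = map₂ there (Interleave-∈⁻ i m)
  Interleave-∈⁻ (iL i) (here p) = inj₁ (here p)
  Interleave-∈⁻ (iL i) (there m) = map₁ there (Interleave-∈⁻ i m)

  Interleave-∈Sˡ : ∀ {Γ} {σ σ₁ σ₂ : Stack Γ} {n} → Interleave σ σ₁ σ₂ → n ∈S σ₁ → n ∈S σ
  Interleave-∈Sˡ i m = ∈⇒∈S (Interleave-∈ˡ i (proj₂ (∈S⇒∈ m)))

  Interleave-∈Sʳ : ∀ {Γ} {σ σ₁ σ₂ : Stack Γ} {n} → Interleave σ σ₁ σ₂ → n ∈S σ₂ → n ∈S σ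
  Interleave-∈Sʳ i = Interleave-∈Sˡ (Interleave-swap i)

  Interleave-headˡ : ∀ {Γ} {e : Entry Γ} {ρ σ₁ σ₂} → Interleave (e ∷ ρ) σ₁ σ₂ → e ∈ σ₁ →
    Unique (e ∷ ρ) → ∃ λ β → σ₁ ≡ e ∷ β × Interleave ρ β σ₂
  Interleave-headˡ (iL i) m u = _ , refl , i
  Interleave-headˡ (iR i) m (a ∷ _) = ⊥-elim (All¬⇒¬Any a (Interleave-∈ˡ i m))

  Interleave-headʳ : ∀ {Γ} {e : Entry Γ} {ρ σ₁ σ₂} → Interleave (e ∷ ρ) σ₁ σ₂ → e ∈ σ₂ →
    Unique (e ∷ ρ) → ∃ λ β → σ₂ ≡ e ∷ β × Interleave ρ σ₁ β
  Interleave-headʳ i m u with Interleave-headˡ (Interleave-swap i) m u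
  ... | β , eq , i′ = β , eq , Interleave-swap i′

  head∉tail : ∀ {Γ} {e : Entry Γ} {σ} → IsStack (e ∷ σ) → e ∈ σ → ⊥
  head∉tail s with IsStack.oncePerTag s
  ... | a ∷ _ = All¬⇒¬Any a

  IsStack-tail : ∀ {Γ} {e : Entry Γ} {σ} → IsStack (e ∷ σ) → IsStack σ
  IsStack-tail s = mkIsStack (Alternating-tail (IsStack⇒Alternating s)) (tail-Unique (IsStack.oncePerTag s))
    adj (All.tail (IsStack.continuation s))
    where
    tail-Unique : Unique (_ ∷ _) → Unique _
    tail-Unique (_ ∷ u) = u
    adj : Adjacent _
    adj p mO mI with IsStack.adjacent s p (there mO) (there mI)
    ... | [] , β , refl = ⊥-elim (head∉tail s mO)
    ... | _ ∷ α , β , refl = α , β , refl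

  O-head⇒I-next : ∀ {Γ} {p : Name Γ} {σ} → IsStack ((O , p) ∷ σ) → (I , p) ∈ σ →
    ∃ λ ρ → σ ≡ (I , p) ∷ ρ
  O-head⇒I-next {p = p} s m with IsStack.adjacent s p (here refl) (there m)
  ... | [] , β , refl = β , refl
  ... | _ ∷ α , β , refl = ⊥-elim (head∉tail s (∈-++⁺ʳ α (here refl)))

  I-head⇒O∉tail : ∀ {Γ} {p : Name Γ} {σ} → IsStack ((I , p) ∷ σ) → (O , p) ∈ σ → ⊥
  I-head⇒O∉tail {p = p} s m with IsStack.adjacent s p (there m) (here refl)
  ... | [] , β , ()
  ... | _ ∷ α , β , refl = head∉tail s (∈-++⁺ʳ α (there (here refl)))

  IsStack-consO : ∀ {Γ} {p : Name Γ} {σ} → IsStack σ → kind (proj₁ p) ≡ co → seqTag (tags σ) ≡ 0 →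
    (p ∈S σ → ∃ λ ρ → σ ≡ (I , p) ∷ ρ) → IsStack ((O , p) ∷ σ)
  IsStack-consO {p = p} {σ} s k sq onlyAtHead = mkIsStack
    (Alternating-consO (IsStack⇒Alternating s) sq)
    (¬Any⇒All¬ σ O∉σ ∷ IsStack.oncePerTag s) adj (k ∷ IsStack.continuation s)
    where
    O∉σ : (O , p) ∈ σ → ⊥
    O∉σ m with onlyAtHead (∈⇒∈S m)
    ... | ρ , refl with m
    ... | there m′ = I-head⇒O∉tail s m′
    adj : Adjacent ((O , p) ∷ σ)
    adj q _ (here ())
    adj q (here refl) (there mI) with onlyAtHead (∈⇒∈S mI)
    ... | ρ , refl = [] , ρ , refl
    adj q (there mO) (there mI) with IsStack.adjacent s q mO mI
    ... | α , β , refl = (O , p) ∷ α , β , refl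

  IsStack-consI : ∀ {Γ} {p : Name Γ} {σ} → IsStack σ → kind (proj₁ p) ≡ co → seqTag (tags σ) ≡ 1 →
    (p ∈S σ → ⊥) → IsStack ((I , p) ∷ σ)
  IsStack-consI {p = p} {σ} s k sq p∉σ = mkIsStack
    (Alternating-consI (IsStack⇒Alternating s) sq)
    (¬Any⇒All¬ σ (λ m → p∉σ (∈⇒∈S m)) ∷ IsStack.oncePerTag s) adj (k ∷ IsStack.continuation s)
    where
    adj : Adjacent ((I , p) ∷ σ)
    adj q (here ()) _
    adj q (there mO) (here refl) = ⊥-elim (p∉σ (∈⇒∈S mO))
    adj q (there mO) (there mI) with IsStack.adjacent s q mO mI
    ... | α , β , refl = (I , p) ∷ α , β , refl

  InjectiveOn : ∀ {Γ Δ} → Ren Γ Δ → Stack Γ → Set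
  InjectiveOn {Γ} ρ σ = ∀ {n m : Name Γ} → n ∈S σ → m ∈S σ → renName ρ n ≡ renName ρ m → n ≡ m

  Unique-renS : ∀ {Γ Δ} (ρ : Ren Γ Δ) {σ} → InjectiveOn ρ σ → Unique σ → Unique (renS ρ σ)
  Unique-renS ρ {[]} inj [] = []
  Unique-renS ρ {e ∷ σ} inj (e∉σ ∷ u) =
    Allₚ.map⁺ (All.tabulate (λ m eq → All.lookup e∉σ m (entry-inj (here refl) (there m) eq))) ∷
    Unique-renS ρ (λ m m′ → inj (there m) (there m′)) u
    where
    entry-inj : ∀ {e₁ e₂} → e₁ ∈ e ∷ σ → e₂ ∈ e ∷ σ → renEntry ρ e₁ ≡ renEntry ρ e₂ → e₁ ≡ e₂
    entry-inj m₁ m₂ eq = cong₂ _,_ (cong proj₁ eq) (inj (∈⇒∈S m₁) (∈⇒∈S m₂) (cong proj₂ eq))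

  IsStack-renS : ∀ {Γ Δ} (ρ : Ren Γ Δ) {σ} → InjectiveOn ρ σ → IsStack σ → IsStack (renS ρ σ)
  IsStack-renS ρ {σ} inj s = mkIsStack
    (subst Alternating (sym (tags-renS ρ σ)) (IsStack⇒Alternating s))
    (Unique-renS ρ inj (IsStack.oncePerTag s)) adj (Allₚ.map⁺ (IsStack.continuation s))
    where
    adj : Adjacent (renS ρ σ)
    adj q mO mI with ∈-map⁻ (renEntry ρ) mO | ∈-map⁻ (renEntry ρ) mI
    ... | (O , n) , m₁ , refl | (I , n′) , m₂ , eq₂
      with inj (∈⇒∈S m₁) (∈⇒∈S m₂) (cong proj₂ eq₂)
    ... | refl with IsStack.adjacent s n m₁ m₂
    ... | α , β , refl = renS ρ α , renS ρ β , renS-++ ρ α _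

  extN-bnd : ∀ {Γ Δ} ss (ρ : Ren Γ Δ) {t} (w : ss ∋ t) → extN ss ρ (bnd {Γ} w) ≡ bnd {Δ} w
  extN-bnd (s ∷ ss) ρ here = refl
  extN-bnd (s ∷ ss) ρ (there w) = cong there (extN-bnd ss ρ w)

  extN-wkIn : ∀ {Γ Δ} ss (ρ : Ren Γ Δ) {t} (v : Γ ∋ t) → extN ss ρ (wkIn ss v) ≡ wkIn ss (ρ v)
  extN-wkIn [] ρ v = refl
  extN-wkIn (s ∷ ss) ρ v = cong there (extN-wkIn ss ρ v)

  inst-bnd : ∀ {Γ ss} (b : Args Γ ss) {t} (w : ss ∋ t) → inst b (bnd {Γ} w) ≡ lookupAll b w
  inst-bnd (x ∷ b) here = refl
  inst-bnd (x ∷ b) (there w) = inst-bnd b w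

  inst-wkIn : ∀ {Γ ss} (b : Args Γ ss) {t} (v : Γ ∋ t) → inst b (wkIn ss v) ≡ v
  inst-wkIn [] v = refl
  inst-wkIn (x ∷ b) v = inst-wkIn b v

  lookupAll-renA : ∀ {Γ Δ ss} (ρ : Ren Γ Δ) (b : Args Γ ss) {t} (w : ss ∋ t) →
    lookupAll (renA ρ b) w ≡ ρ (lookupAll b w)
  lookupAll-renA ρ (x ∷ b) here = refl
  lookupAll-renA ρ (x ∷ b) (there w) = lookupAll-renA ρ b w

  ext-cong : ∀ {Γ Δ s} {f g : Ren Γ Δ} → (∀ {t} (v : Γ ∋ t) → f v ≡ g v) →
    ∀ {t} (v : (s ∷ Γ) ∋ t) → ext f v ≡ ext g v
  ext-cong h here = refl
  ext-cong h (there v) = cong there (h v)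

  ⊕-ext-cong : ∀ {Γ Δ} cs {f g : Ren Γ Δ} → (∀ {t} (v : Γ ∋ t) → f v ≡ g v) →
    ∀ {t} (v : (cs ⊕ Γ) ∋ t) → ⊕-ext cs f v ≡ ⊕-ext cs g v
  ⊕-ext-cong [] h v = h v
  ⊕-ext-cong (c ∷ cs) h v = ⊕-ext-cong cs (ext-cong h) v

  ext-∘ : ∀ {Γ Δ Θ s} (f : Ren Δ Θ) (g : Ren Γ Δ) {t} (v : (s ∷ Γ) ∋ t) →
    ext f (ext g v) ≡ ext (λ x → f (g x)) v
  ext-∘ f g here = refl
  ext-∘ f g (there v) = refl

  ⊕-ext-∘ : ∀ {Γ Δ Θ} cs (f : Ren Δ Θ) (g : Ren Γ Δ) {t} (v : (cs ⊕ Γ) ∋ t) →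
    ⊕-ext cs f (⊕-ext cs g v) ≡ ⊕-ext cs (λ x → f (g x)) v
  ⊕-ext-∘ [] f g v = refl
  ⊕-ext-∘ (c ∷ cs) f g v = trans (⊕-ext-∘ cs (ext f) (ext g) v) (⊕-ext-cong cs (ext-∘ f g) v)

  ⊕-ext-wkOut : ∀ {Γ Δ} cs (ρ : Ren Γ Δ) {t} (v : Γ ∋ t) → ⊕-ext cs ρ (wkOut cs v) ≡ wkOut cs (ρ v)
  ⊕-ext-wkOut [] ρ v = refl
  ⊕-ext-wkOut (c ∷ cs) ρ v = ⊕-ext-wkOut cs (ext ρ) (there v)

  lookupAll-there-wkOut : ∀ {Γ t₀ ss} cs (b : Args (cs ⊕ Γ) ss) {t} (w : ss ∋ t) (q : Γ ∋ t) →
    lookupAll b w ≡ wkOut cs q → lookupAll (renA (⊕-ext cs (there {y = t₀})) b) w ≡ wkOut cs (there q)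
  lookupAll-there-wkOut cs b w q eq =
    trans (lookupAll-renA _ b w) (trans (cong (⊕-ext cs there) eq) (⊕-ext-wkOut cs there q))

  swapOut-wkOut : ∀ {Γ t} cs {u} (v : (t ∷ Γ) ∋ u) → swapOut {Γ} {t} cs (wkOut cs v) ≡ ext (wkOut cs) v
  swapOut-wkOut [] here = refl
  swapOut-wkOut [] (there v) = refl
  swapOut-wkOut {Γ} {t} (c ∷ cs) v = trans
    (cong (swapOut {c ∷ Γ} {t} cs) (⊕-ext-wkOut cs exch (there v)))
    (trans (swapOut-wkOut {c ∷ Γ} {t} cs (exch (there v))) (lemma v))
    where
    lemma : ∀ {u} (v : (t ∷ Γ) ∋ u) → ext (wkOut cs) (exch (there v)) ≡ ext (wkOut (c ∷ cs)) v
    lemma here = refl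
    lemma (there v) = refl

  swapOut-⊕-ext-there : ∀ {Γ s} cs {t} (v : (cs ⊕ Γ) ∋ t) →
    swapOut {Γ} {s} cs (⊕-ext cs there v) ≡ there v
  swapOut-⊕-ext-there [] v = refl
  swapOut-⊕-ext-there {Γ} {s} (c ∷ cs) v = trans
    (cong (swapOut {c ∷ Γ} {s} cs) (trans (⊕-ext-∘ cs exch (ext there) v) (⊕-ext-cong cs exch-there v)))
    (swapOut-⊕-ext-there {c ∷ Γ} {s} cs v)
    where
    exch-there : ∀ {t} (x : (c ∷ Γ) ∋ t) → exch (ext there x) ≡ there x
    exch-there here = refl
    exch-there (there x) = refl

  RenInjective : ∀ {Γ Δ} → Ren Γ Δ → Set
  RenInjective ρ = Injective _≡_ _≡_ (renName ρ)

  renName-there-injective : ∀ {Γ s t t′} {v : Γ ∋ t} {w : Γ ∋ t′} →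
    _≡_ {A = Name (s ∷ Γ)} (t , there v) (t′ , there w) → _≡_ {A = Name Γ} (t , v) (t′ , w)
  renName-there-injective refl = refl

  there-injective : ∀ {Γ s} → RenInjective (λ {t} (v : Γ ∋ t) → there {y = s} v)
  there-injective = renName-there-injective

  ext-injective : ∀ {Γ Δ s} {ρ : Ren Γ Δ} → RenInjective ρ → RenInjective (ext {t = s} ρ)
  ext-injective inj {t , here} {.t , here} refl = refl
  ext-injective inj {t , there v} {t′ , there w} eq with inj {t , v} {t′ , w} (renName-there-injective eq)
  ... | refl = refl

  ⊕-ext-injective : ∀ {Γ Δ} cs {ρ : Ren Γ Δ} → RenInjective ρ → RenInjective (⊕-ext cs ρ)
  ⊕-ext-injective [] inj = inj
  ⊕-ext-injective (c ∷ cs) inj = ⊕-ext-injective cs (ext-injective inj)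

  wkOut-injective : ∀ {Γ} cs → RenInjective (wkOut {Γ} cs)
  wkOut-injective [] eq = eq
  wkOut-injective {Γ} (c ∷ cs) eq = there-injective (wkOut-injective {c ∷ Γ} cs eq)

  wkIn-injective : ∀ {Γ} ss → RenInjective (wkIn {Γ} ss)
  wkIn-injective [] eq = eq
  wkIn-injective (s ∷ ss) eq = wkIn-injective ss (there-injective eq)

  exch-involutive : ∀ {Γ s t u} (v : (s ∷ t ∷ Γ) ∋ u) → exch (exch v) ≡ v
  exch-involutive here = refl
  exch-involutive (there here) = refl
  exch-involutive (there (there v)) = refl

  exch-injective : ∀ {Γ s t} → RenInjective (exch {Γ} {s} {t})
  exch-injective {x = u , v} {u′ , v′} eq with cong (renName exch) eq
  ... | eq′ rewrite exch-involutive v | exch-involutive v′ = eq′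

  swapOut-injective : ∀ {Γ t} cs → RenInjective (swapOut {Γ} {t} cs)
  swapOut-injective [] eq = eq
  swapOut-injective {Γ} {t} (c ∷ cs) eq =
    ⊕-ext-injective cs exch-injective (swapOut-injective {c ∷ Γ} {t} cs eq)

  injective⇒var : ∀ {Γ Δ} {ρ : Ren Γ Δ} → RenInjective ρ → ∀ {t} {v w : Γ ∋ t} → ρ v ≡ ρ w → v ≡ w
  injective⇒var inj {t} {v} {w} eq with inj {t , v} {t , w} (cong (t ,_) eq)
  ... | refl = refl

  injective⇒InjectiveOn : ∀ {Γ Δ} {ρ : Ren Γ Δ} → RenInjective ρ → ∀ σ → InjectiveOn ρ σ
  injective⇒InjectiveOn inj σ _ _ = inj

  wkOut? : ∀ {Γ} cs {t} (v : (cs ⊕ Γ) ∋ t) → Dec (∃ λ (w : Γ ∋ t) → v ≡ wkOut cs w)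
  wkOut? [] v = yes (v , refl)
  wkOut? {Γ} (c ∷ cs) v with wkOut? {c ∷ Γ} cs v
  ... | no ¬old = no λ (w , eq) → ¬old (there w , eq)
  ... | yes (there w , eq) = yes (w , eq)
  ... | yes (here , eq) =
    no λ (w , eq′) → here≢there (injective⇒var (wkOut-injective {c ∷ Γ} cs) (trans (sym eq) eq′))
    where
    here≢there : ∀ {w : Γ ∋ c} → _≡_ {A = (c ∷ Γ) ∋ c} here (there w) → ⊥
    here≢there ()

  fresh∉renS-wkOut : ∀ {Γ} cs {σ : Stack Γ} {t} {p : (cs ⊕ Γ) ∋ t} → (¬ ∃ λ q → p ≡ wkOut cs q) →
    (t , p) ∈S renS (wkOut cs) σ → ⊥
  fresh∉renS-wkOut cs {σ} fresh m with ∈S-renS⁻ (wkOut cs) σ m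
  ... | (t′ , v) , _ , refl = fresh (v , refl)

  fresh-⊕-ext-there : ∀ {Γ t₀} cs {t} {p : (cs ⊕ Γ) ∋ t} → (¬ ∃ λ q → p ≡ wkOut cs q) →
    ¬ ∃ λ q → ⊕-ext cs (there {y = t₀}) p ≡ wkOut cs q
  fresh-⊕-ext-there {Γ} {t₀} cs {p = p} fresh (here , eq)
    with trans (sym (swapOut-⊕-ext-there {Γ} {t₀} cs p)) (trans (cong (swapOut cs) eq) (swapOut-wkOut cs here))
  ... | ()
  fresh-⊕-ext-there cs {p = p} fresh (there q , eq) =
    fresh (q , injective⇒var (⊕-ext-injective cs there-injective) (trans eq (sym (⊕-ext-wkOut cs there q))))

  co≢ic : co ≢ ic
  co≢ic ()

  oc≢ic : oc ≢ ic
  oc≢ic ()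

  co≢oc : co ≢ oc
  co≢oc ()

  ArgOcc-lookupAll : ∀ {Γ ss} (b : Args Γ ss) {t} (w : ss ∋ t) → ArgOcc (lookupAll b w) b
  ArgOcc-lookupAll (x ∷ b) here = inj₁ refl
  ArgOcc-lookupAll (x ∷ b) (there w) = inj₂ (ArgOcc-lookupAll b w)

  ArgOcc⇒lookupAll : ∀ {Γ ss} (b : Args Γ ss) {t} {v : Γ ∋ t} → ArgOcc v b →
    ∃₂ λ t′ (w : ss ∋ t′) → v ≈ₙ lookupAll b w
  ArgOcc⇒lookupAll (x ∷ b) (inj₁ eq) = _ , here , eq
  ArgOcc⇒lookupAll (x ∷ b) (inj₂ o) with ArgOcc⇒lookupAll b o
  ... | t′ , w , eq = t′ , there w , eq

  continuation-position-unique : ∀ {s} → kind s ≡ oc → ∀ {t₁ t₂} (w₁ : obj s ∋ t₁) (w₂ : obj s ∋ t₂) →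
    kind t₁ ≡ co → kind t₂ ≡ co → _≡_ {A = Σ Sort (obj s ∋_)} (t₁ , w₁) (t₂ , w₂)
  continuation-position-unique {s} ks with obj s | obj-oc s ks
  ... | .(ts ++ t ∷ []) | ts , t , refl , _ , ¬co = unique ts ¬co
    where
    unique : ∀ ts → All (λ t′ → kind t′ ≢ co) ts → ∀ {t₁ t₂} (w₁ : (ts ++ t ∷ []) ∋ t₁)
      (w₂ : (ts ++ t ∷ []) ∋ t₂) → kind t₁ ≡ co → kind t₂ ≡ co →
      _≡_ {A = Σ Sort ((ts ++ t ∷ []) ∋_)} (t₁ , w₁) (t₂ , w₂)
    unique [] _ here here _ _ = refl
    unique (_ ∷ ts) (n ∷ _) here _ k₁ _ = ⊥-elim (n k₁)
    unique (_ ∷ ts) (n ∷ _) (there _) here _ k₂ = ⊥-elim (n k₂)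
    unique (_ ∷ ts) (_ ∷ ¬co) (there w₁) (there w₂) k₁ k₂ with unique ts ¬co w₁ w₂ k₁ k₂
    ... | refl = refl

  continuation-position : ∀ {s} → kind s ≡ oc → ∃ λ t → obj s ∋ t × kind t ≡ co
  continuation-position {s} ks with obj s | obj-oc s ks
  ... | .(ts ++ t ∷ []) | ts , t , refl , kt , _ = t , last ts , kt
    where
    last : ∀ ts → (ts ++ t ∷ []) ∋ t
    last [] = here
    last (_ ∷ ts) = there (last ts)

  ArgOcc-continuation : ∀ {Γ s} (b : Args Γ (obj s)) → kind s ≡ oc → ∀ {t} (w : obj s ∋ t) →
    kind t ≡ co → ∀ {t′} {v : Γ ∋ t′} → ArgOcc v b → kind t′ ≡ co → v ≈ₙ lookupAll b w
  ArgOcc-continuation b ks w kt o kt′ with ArgOcc⇒lookupAll b o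
  ... | _ , w′ , refl with continuation-position-unique ks w′ w kt′ kt
  ... | refl = refl

  ArgOcc-non-continuation : ∀ {Γ s} (b : Args Γ (obj s)) → kind s ≢ oc →
    ∀ {t′} {v : Γ ∋ t′} → ArgOcc v b → kind t′ ≢ co
  ArgOcc-non-continuation {s = s} b ks o with ArgOcc⇒lookupAll b o
  ... | _ , w , refl = lookupAll (obj-other s ks) w

  bodyStack : ∀ {Γ} t → Stack Γ → Stack Γ → Stack (t ∷ Γ)
  bodyStack t ξ σ′ = renS there ξ ++ (O , (t , here)) ∷ (I , (t , here)) ∷ renS there σ′

  ∈S-bodyStack⁻ : ∀ {Γ t} ξ σ′ {n : Name (t ∷ Γ)} → n ∈S bodyStack t ξ σ′ →
    n ≡ (t , here) ⊎ ∃ λ n′ → n ≡ renName there n′ × n′ ∈S (ξ ++ σ′)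
  ∈S-bodyStack⁻ ξ σ′ m with Anyₚ.++⁻ (renS there ξ) m
  ... | inj₁ m₁ with ∈S-renS⁻ there ξ m₁
  ... | n′ , m′ , eq = inj₂ (n′ , eq , Anyₚ.++⁺ˡ m′)
  ∈S-bodyStack⁻ ξ σ′ m | inj₂ (here refl) = inj₁ refl
  ∈S-bodyStack⁻ ξ σ′ m | inj₂ (there (here refl)) = inj₁ refl
  ∈S-bodyStack⁻ ξ σ′ m | inj₂ (there (there m₂)) with ∈S-renS⁻ there σ′ m₂
  ... | n′ , m′ , eq = inj₂ (n′ , eq , Anyₚ.++⁺ʳ ξ m′)

  InjectiveOn-singleton : ∀ {Γ Δ} (ρ : Ren Γ Δ) (e : Entry Γ) → InjectiveOn ρ (e ∷ [])
  InjectiveOn-singleton ρ e (here refl) (here refl) _ = refl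

  InjectiveOn-Interleave : ∀ {Γ Δ} {ρ : Ren Γ Δ} {σ σ₁ σ₂} → InjectiveOn ρ σ →
    Interleave σ σ₁ σ₂ → InjectiveOn ρ σ₁
  InjectiveOn-Interleave inj i m m′ = inj (Interleave-∈Sˡ i m) (Interleave-∈Sˡ i m′)

  InjectiveOn-bodyStack : ∀ {Γ Δ t} {ρ : Ren Γ Δ} ξ σ′ → InjectiveOn ρ (ξ ++ σ′) →
    InjectiveOn (ext {t = t} ρ) (bodyStack t ξ σ′)
  InjectiveOn-bodyStack ξ σ′ inj m m′ eq with ∈S-bodyStack⁻ ξ σ′ m | ∈S-bodyStack⁻ ξ σ′ m′
  ... | inj₁ refl | inj₁ refl = refl
  ... | inj₁ refl | inj₂ (_ , refl , _) with eq
  ... | ()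
  InjectiveOn-bodyStack ξ σ′ inj m m′ eq | inj₂ (_ , refl , _) | inj₁ refl with eq
  ... | ()
  InjectiveOn-bodyStack ξ σ′ inj m m′ eq | inj₂ (_ , refl , a) | inj₂ (_ , refl , a′) =
    cong (renName there) (inj a a′ (renName-there-injective eq))

  InjectiveOn-renS-there : ∀ {Γ Δ t} {ρ : Ren Γ Δ} σ → InjectiveOn ρ σ →
    InjectiveOn (ext {t = t} ρ) (renS there σ)
  InjectiveOn-renS-there σ inj m m′ eq with ∈S-renS⁻ there σ m | ∈S-renS⁻ there σ m′
  ... | _ , a , refl | _ , a′ , refl = cong (renName there) (inj a a′ (renName-there-injective eq))

  renS-ext-there : ∀ {Γ Δ t} (ρ : Ren Γ Δ) σ →
    renS (ext {t = t} ρ) (renS there σ) ≡ renS there (renS ρ σ)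
  renS-ext-there ρ σ = trans (renS-∘ (ext ρ) there σ) (sym (renS-∘ there ρ σ))

  renS-bodyStack : ∀ {Γ Δ t} (ρ : Ren Γ Δ) ξ σ′ →
    renS (ext {t = t} ρ) (bodyStack t ξ σ′) ≡ bodyStack t (renS ρ ξ) (renS ρ σ′)
  renS-bodyStack ρ ξ σ′ = trans (renS-++ (ext ρ) (renS there ξ) _)
    (cong₂ (λ A B → A ++ (O , (_ , here)) ∷ (I , (_ , here)) ∷ B)
      (renS-ext-there ρ ξ) (renS-ext-there ρ σ′))

  ⊢W-subst : ∀ {Γ} {σ σ′ : Stack Γ} {P} → σ ≡ σ′ → ⊢W[ σ ] P → ⊢W[ σ′ ] P
  ⊢W-subst refl d = d

  ⊢W-rename : ∀ {Γ Δ} (ρ : Ren Γ Δ) {σ P} → InjectiveOn ρ σ → ⊢W[ σ ] P → ⊢W[ renS ρ σ ] renP ρ P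
  ⊢WG-rename : ∀ {Γ Δ} (ρ : Ren Γ Δ) {σ G} → InjectiveOn ρ σ → ⊢WG[ σ ] G → ⊢WG[ renS ρ σ ] renG ρ G
  ⊢W-rename ρ inj (wOutP k) = wOutP k
  ⊢W-rename ρ inj (wOutX {t = t} {a = a} {b = b} w ks kt) =
    subst (λ x → ⊢W[ (O , (t , x)) ∷ [] ] out (ρ a) (renA ρ b)) (lookupAll-renA ρ b w) (wOutX w ks kt)
  ⊢W-rename ρ inj (wOutU k) = wOutU k
  ⊢W-rename ρ inj (wRep {s = s} {t = t} w ks kt d) =
    wRep w ks kt (subst (λ x → ⊢W[ (O , (t , x)) ∷ [] ] _) (extN-bnd (obj s) ρ w)
      (⊢W-rename (extN (obj s) ρ) (InjectiveOn-singleton _ _) d))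
  ⊢W-rename ρ inj (wPar d₁ d₂ (st , i)) =
    wPar (⊢W-rename ρ (InjectiveOn-Interleave inj i) d₁)
         (⊢W-rename ρ (InjectiveOn-Interleave inj (Interleave-swap i)) d₂)
         (IsStack-renS ρ inj st , Interleave-renS ρ i)
  ⊢W-rename ρ inj (wResC ξ σ′ k c d) =
    ⊢W-subst (sym (renS-++ ρ ξ σ′))
      (wResC (renS ρ ξ) (renS ρ σ′) k (EmptyOrEndsWith-renS ρ c)
        (⊢W-subst (renS-bodyStack ρ ξ σ′) (⊢W-rename (ext ρ) (InjectiveOn-bodyStack ξ σ′ inj) d)))
  ⊢W-rename ρ inj (wRes {σ = σ} d) =
    wRes (⊢W-subst (renS-ext-there ρ σ) (⊢W-rename (ext ρ) (InjectiveOn-renS-there σ inj) d))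
  ⊢W-rename ρ inj (wGrd g) = wGrd (⊢WG-rename ρ inj g)
  ⊢WG-rename ρ inj (wInC {s = s} p ks kp ne d) =
    wInC (renName ρ p) ks kp (λ eq → ne (inj (here refl) (there (here refl)) eq))
      (subst (λ x → ⊢W[ (O , (proj₁ p , x)) ∷ [] ] _) (extN-wkIn (obj s) ρ (proj₂ p))
        (⊢W-rename (extN (obj s) ρ) (InjectiveOn-singleton _ _) d))
  ⊢WG-rename ρ inj (wInX {s = s} {t = t} w ks kt d) =
    wInX w ks kt (subst (λ x → ⊢W[ (O , (t , x)) ∷ [] ] _) (extN-bnd (obj s) ρ w)
      (⊢W-rename (extN (obj s) ρ) (InjectiveOn-singleton _ _) d))
  ⊢WG-rename ρ inj (wInU {s = s} p ks kp d) =
    wInU (renName ρ p) ks kp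
      (subst (λ x → ⊢W[ (O , (proj₁ p , x)) ∷ [] ] _) (extN-wkIn (obj s) ρ (proj₂ p))
        (⊢W-rename (extN (obj s) ρ) (InjectiveOn-singleton _ _) d))
  ⊢WG-rename ρ inj wNil = wNil
  ⊢WG-rename ρ inj (wMatch g) = wMatch (⊢WG-rename ρ (λ ()) g)
  ⊢WG-rename ρ inj (wTau {σ = σ} d l) =
    wTau (⊢W-rename ρ inj d) (subst (_≤ 1) (sym (length-map _ σ)) l)
  ⊢WG-rename ρ inj (wSum {σ = σ} g h l) =
    wSum (⊢WG-rename ρ inj g) (⊢WG-rename ρ inj h) (subst (_≤ 1) (sym (length-map _ σ)) l)

  ⊢S-rename : ∀ {Γ Δ} (ρ : Ren Γ Δ) {η P} → ⊢S[ η ] P → ⊢S[ η ] renP ρ P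
  ⊢SG-rename : ∀ {Γ Δ} (ρ : Ren Γ Δ) {η G} → ⊢SG[ η ] G → ⊢SG[ η ] renG ρ G
  ⊢S-rename ρ (sOutO k) = sOutO k
  ⊢S-rename ρ (sOutI k) = sOutI k
  ⊢S-rename ρ (sRep {s = s} k d) = sRep k (⊢S-rename (extN (obj s) ρ) d)
  ⊢S-rename ρ (sPar d e l) = sPar (⊢S-rename ρ d) (⊢S-rename ρ e) l
  ⊢S-rename ρ (sRes d) = sRes (⊢S-rename (ext ρ) d)
  ⊢S-rename ρ (sGrd g) = sGrd (⊢SG-rename ρ g)
  ⊢SG-rename ρ sNil = sNil
  ⊢SG-rename ρ (sInI {s = s} k d) = sInI k (⊢S-rename (extN (obj s) ρ) d)
  ⊢SG-rename ρ (sInO {s = s} k d) = sInO k (⊢S-rename (extN (obj s) ρ) d)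
  ⊢SG-rename ρ (sTau d) = sTau (⊢S-rename ρ d)
  ⊢SG-rename ρ (sMatch g) = sMatch (⊢SG-rename ρ g)
  ⊢SG-rename ρ (sSum g h) = sSum (⊢SG-rename ρ g) (⊢SG-rename ρ h)

  tags-bodyStack : ∀ {Γ t} (ξ σ′ : Stack Γ) → tags (bodyStack t ξ σ′) ≡ tags ξ ++ O ∷ I ∷ tags σ′
  tags-bodyStack ξ σ′ = trans (map-++ proj₁ (renS there ξ) _)
    (cong₂ (λ A B → A ++ O ∷ I ∷ B) (tags-renS there ξ) (tags-renS there σ′))

  Alternating-bodyStack⁻ : ∀ {Γ t} (ξ σ′ : Stack Γ) → EmptyOrEndsWith I ξ →
    Alternating (tags (bodyStack t ξ σ′)) → Alternating (tags (ξ ++ σ′))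
  Alternating-bodyStack⁻ ξ σ′ c a = subst Alternating (sym (map-++ proj₁ ξ σ′))
    (Alternating-cut (tags ξ) (tags σ′) (ends c) (subst Alternating (tags-bodyStack ξ σ′) a))
    where
    ends : EmptyOrEndsWith I ξ → (tags ξ ≡ [] ⊎ ∃ λ A₀ → tags ξ ≡ A₀ ∷ʳ I)
    ends (inj₁ refl) = inj₁ refl
    ends (inj₂ (ξ₀ , p , refl)) = inj₂ (tags ξ₀ , map-++ proj₁ ξ₀ _)

  ⊢W⇒Alternating : ∀ {Γ} {σ : Stack Γ} {P} → ⊢W[ σ ] P → Alternating (tags σ)
  ⊢WG⇒Alternating : ∀ {Γ} {σ : Stack Γ} {G} → ⊢WG[ σ ] G → Alternating (tags σ)
  ⊢W⇒Alternating (wOutP _) = alO O∷[]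
  ⊢W⇒Alternating (wOutX _ _ _) = alO O∷[]
  ⊢W⇒Alternating (wOutU _) = empty
  ⊢W⇒Alternating (wRep _ _ _ _) = empty
  ⊢W⇒Alternating (wPar _ _ (st , _)) = IsStack⇒Alternating st
  ⊢W⇒Alternating (wResC ξ σ′ _ c d) = Alternating-bodyStack⁻ ξ σ′ c (⊢W⇒Alternating d)
  ⊢W⇒Alternating (wRes {σ = σ} d) = subst Alternating (tags-renS there σ) (⊢W⇒Alternating d)
  ⊢W⇒Alternating (wGrd g) = ⊢WG⇒Alternating g
  ⊢WG⇒Alternating (wInC _ _ _ _ _) = alI (I∷ O∷[])
  ⊢WG⇒Alternating (wInX _ _ _ _) = empty
  ⊢WG⇒Alternating (wInU _ _ _ _) = alO O∷[]
  ⊢WG⇒Alternating wNil = empty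
  ⊢WG⇒Alternating (wMatch _) = empty
  ⊢WG⇒Alternating (wTau d _) = ⊢W⇒Alternating d
  ⊢WG⇒Alternating (wSum g _ _) = ⊢WG⇒Alternating g

  seqTag≡parity-⊢W : ∀ {Γ} {σ : Stack Γ} {P} → ⊢W[ σ ] P → seqTag (tags σ) ≡ parity (length σ)
  seqTag≡parity-⊢W {σ = σ} d = seqTag≡parity-length σ (⊢W⇒Alternating d)

  -- In a parallel composition the levels add up and so do the stack lengths; seq is their parity.
  level≡seqTag : ∀ {Γ} {σ : Stack Γ} {P η} → ⊢W[ σ ] P → ⊢S[ η ] P → η ≡ seqTag (tags σ)
  levelG≡seqTag : ∀ {Γ} {σ : Stack Γ} {G η} → ⊢WG[ σ ] G → ⊢SG[ η ] G → η ≡ seqTag (tags σ)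
  level≡seqTag (wOutP k) (sOutO _) = refl
  level≡seqTag (wOutP k) (sOutI k′) = ⊥-elim (co≢ic (trans (sym k) k′))
  level≡seqTag (wOutX _ k _) (sOutO _) = refl
  level≡seqTag (wOutX _ k _) (sOutI k′) = ⊥-elim (oc≢ic (trans (sym k) k′))
  level≡seqTag (wOutU k) (sOutO k′) = ⊥-elim (k′ k)
  level≡seqTag (wOutU k) (sOutI _) = refl
  level≡seqTag (wRep _ _ _ _) (sRep _ _) = refl
  level≡seqTag (wPar {σ = σ} {σ₁} {σ₂} d₁ d₂ (st , i)) (sPar {η₁ = η₁} {η₂} e₁ e₂ l) =
    sum η₁ η₂ (level≡seqTag d₁ e₁) (level≡seqTag d₂ e₂) l
    where
    seqσ : seqTag (tags σ) ≡ parity (length σ₁ + length σ₂)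
    seqσ = trans (seqTag≡parity-length σ (IsStack⇒Alternating st)) (cong parity (Interleave-length i))
    sum : ∀ η₁ η₂ → η₁ ≡ seqTag (tags σ₁) → η₂ ≡ seqTag (tags σ₂) → η₁ + η₂ ≤ 1 →
      η₁ + η₂ ≡ seqTag (tags σ)
    sum zero η₂ e₁ e₂ _ = sym (begin
      seqTag (tags σ)                   ≡⟨ seqσ ⟩
      parity (length σ₁ + length σ₂)    ≡⟨ parity-+-evenˡ (length σ₁) (length σ₂) (trans (sym (seqTag≡parity-⊢W d₁)) (sym e₁)) ⟩
      parity (length σ₂)                ≡⟨ sym (seqTag≡parity-⊢W d₂) ⟩
      seqTag (tags σ₂)                  ≡⟨ sym e₂ ⟩
      η₂                                ∎)
      where open ≡-Reasoning
    sum (suc zero) zero e₁ e₂ _ = sym (begin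
      seqTag (tags σ)                   ≡⟨ seqσ ⟩
      parity (length σ₁ + length σ₂)    ≡⟨ parity-+-evenʳ (length σ₁) (length σ₂) (trans (sym (seqTag≡parity-⊢W d₂)) (sym e₂)) ⟩
      parity (length σ₁)                ≡⟨ sym (seqTag≡parity-⊢W d₁) ⟩
      seqTag (tags σ₁)                  ≡⟨ sym e₁ ⟩
      1                                 ∎)
      where open ≡-Reasoning
    sum (suc zero) (suc _) _ _ (s≤s ())
    sum (suc (suc _)) _ _ _ (s≤s ())
  level≡seqTag (wResC [] σ′ _ c d) (sRes e) with ⊢W⇒Alternating d
  ... | alO (O∷ I∷ a) = trans (level≡seqTag d e) (trans (sym (seqTag-AltO a)) (cong seqTag (tags-renS there σ′)))
  level≡seqTag (wResC ((g , n) ∷ ξ) σ′ _ c d) (sRes e) = trans (level≡seqTag d e) (seqTag-cong-head g _ _)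
  level≡seqTag (wRes {σ = σ} d) (sRes e) = trans (level≡seqTag d e) (cong seqTag (tags-renS there σ))
  level≡seqTag (wGrd g) (sGrd e) = levelG≡seqTag g e
  levelG≡seqTag (wInC _ k _ _ _) (sInI k′ _) = ⊥-elim (co≢ic (trans (sym k) k′))
  levelG≡seqTag (wInC _ k _ _ _) (sInO _ _) = refl
  levelG≡seqTag (wInX _ k _ _) (sInI k′ _) = ⊥-elim (oc≢ic (trans (sym k) k′))
  levelG≡seqTag (wInX _ k _ _) (sInO _ _) = refl
  levelG≡seqTag (wInU _ k _ _) (sInI _ _) = refl
  levelG≡seqTag (wInU _ k _ _) (sInO k′ _) = ⊥-elim (k′ k)
  levelG≡seqTag wNil sNil = refl
  levelG≡seqTag (wMatch _) (sMatch _) = refl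
  levelG≡seqTag (wTau d _) (sTau e) = level≡seqTag d e
  levelG≡seqTag (wSum g _ _) (sSum e _) = levelG≡seqTag g e

  guard-no-output : ∀ {Γ} {G : Guard Γ} {cs s} {a : Γ ∋ s} {b P′} → G —G[ outA cs a b ]→ P′ → ⊥
  guard-no-output (tMatch t) = guard-no-output t
  guard-no-output (tSumL t) = guard-no-output t
  guard-no-output (tSumR t) = guard-no-output t

  1+n≤1⇒n≡0 : ∀ {η₁ η₂} → η₁ ≡ 1 → η₁ + η₂ ≤ 1 → η₂ ≡ 0
  1+n≤1⇒n≡0 refl l = n≤0⇒n≡0 (s≤s⁻¹ l)

  n+1≤1⇒n≡0 : ∀ {η₁ η₂} → η₂ ≡ 1 → η₁ + η₂ ≤ 1 → η₁ ≡ 0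
  n+1≤1⇒n≡0 {η₁} refl l = 1+n≤1⇒n≡0 refl (subst (_≤ 1) (+-comm η₁ 1) l)

  output-level : ∀ {Γ cs s} {a : Γ ∋ s} {b} {P : Proc Γ} {P′ η} → kind s ≢ ic → ⊢S[ η ] P →
    P —[ outA cs a b ]→ P′ → η ≡ 1
  output-level k (sOutO _) tOut = refl
  output-level k (sOutI k′) tOut = ⊥-elim (k k′)
  output-level k (sGrd _) (tGrd t) = ⊥-elim (guard-no-output t)
  output-level k (sPar e₁ e₂ l) (tParL t) with output-level k e₁ t
  ... | refl = cong suc (1+n≤1⇒n≡0 refl l)
  output-level k (sPar {η₁ = η₁} e₁ e₂ l) (tParR t) with output-level k e₂ t
  ... | refl = trans (cong (_+ 1) (n+1≤1⇒n≡0 refl l)) refl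
  output-level k (sRes e) (tRes t) = output-level k e t
  output-level k (sRes e) (tOpen t _) = output-level k e t

  seqTag-partner-zeroʳ : ∀ {Γ} {σ₂ : Stack Γ} {Q η₁ η₂} → ⊢W[ σ₂ ] Q → ⊢S[ η₂ ] Q → η₁ ≡ 1 →
    η₁ + η₂ ≤ 1 → seqTag (tags σ₂) ≡ 0
  seqTag-partner-zeroʳ d e h l = trans (sym (level≡seqTag d e)) (1+n≤1⇒n≡0 h l)

  seqTag-partner-zeroˡ : ∀ {Γ} {σ₁ : Stack Γ} {P η₁ η₂} → ⊢W[ σ₁ ] P → ⊢S[ η₁ ] P → η₂ ≡ 1 →
    η₁ + η₂ ≤ 1 → seqTag (tags σ₁) ≡ 0
  seqTag-partner-zeroˡ d e h l = trans (sym (level≡seqTag d e)) (n+1≤1⇒n≡0 h l)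

  -- The partner stack has even length, so the interleaving must start on the left.
  Interleave-head-O : ∀ {Γ} {σ σ₂ ρ₁ : Stack Γ} {n} → IsStack σ → Interleave σ ((O , n) ∷ ρ₁) σ₂ →
    Alternating (tags ((O , n) ∷ ρ₁)) → Alternating (tags σ₂) → seqTag (tags σ₂) ≡ 0 →
    ∃ λ ρ → σ ≡ (O , n) ∷ ρ × Interleave ρ ρ₁ σ₂
  Interleave-head-O st (iL i) a₁ a₂ z = _ , refl , i
  Interleave-head-O {σ = (O , m) ∷ σ′} {(O , m) ∷ σ₂′} st (iR i) a₁ a₂ ()
  Interleave-head-O {σ = (I , m) ∷ σ′} {(I , m) ∷ σ₂′} {ρ₁} {n} st (iR i) a₁ a₂ z = ⊥-elim (1+n≢0 (sym 0≡1))
    where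
    open ≡-Reasoning
    0≡1 : 0 ≡ 1
    0≡1 = begin
      0                                                          ≡⟨ seqTag≡parity-length ((I , m) ∷ σ′) (IsStack⇒Alternating st) ⟩
      parity (length ((I , m) ∷ σ′))                             ≡⟨ cong parity (Interleave-length (iR {t = (I , m)} i)) ⟩
      parity (length ((O , n) ∷ ρ₁) + length ((I , m) ∷ σ₂′))    ≡⟨ parity-+-evenʳ (length ((O , n) ∷ ρ₁)) _
                                                                      (trans (sym (seqTag≡parity-length ((I , m) ∷ σ₂′) a₂)) z) ⟩
      parity (length ((O , n) ∷ ρ₁))                             ≡⟨ sym (seqTag≡parity-length ((O , n) ∷ ρ₁) a₁) ⟩
      1                                                          ∎

  IsStack-wkOut : ∀ {Γ} cs {σ : Stack Γ} → IsStack σ → IsStack (renS (wkOut cs) σ)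
  IsStack-wkOut cs = IsStack-renS (wkOut cs) (injective⇒InjectiveOn (wkOut-injective cs) _)

  ⊢W-wkP : ∀ {Γ} cs {σ : Stack Γ} {Q} → ⊢W[ σ ] Q → ⊢W[ renS (wkOut cs) σ ] wkP cs Q
  ⊢W-wkP [] {σ} d = ⊢W-subst (sym (renS-id σ)) d
  ⊢W-wkP (c ∷ cs) {σ} d = ⊢W-rename (wkOut (c ∷ cs)) (injective⇒InjectiveOn (wkOut-injective (c ∷ cs)) σ) d

  ⊢S-wkP : ∀ {Γ} cs {η} {Q : Proc Γ} → ⊢S[ η ] Q → ⊢S[ η ] wkP cs Q
  ⊢S-wkP [] d = d
  ⊢S-wkP (c ∷ cs) d = ⊢S-rename (wkOut (c ∷ cs)) d

  ⊢W-swapOut : ∀ {Γ t} cs {X : Stack (t ∷ Γ)} {P′} → ⊢W[ renS (wkOut cs) X ] P′ →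
    ⊢W[ renS (ext (wkOut cs)) X ] renP (swapOut cs) P′
  ⊢W-swapOut cs {X} d = ⊢W-subst
    (trans (renS-∘ (swapOut cs) (wkOut cs) X) (renS-cong (swapOut-wkOut cs) X))
    (⊢W-rename (swapOut cs) (injective⇒InjectiveOn (swapOut-injective cs) _) d)

  ⊢W-ν-swapOut : ∀ {Γ t} cs {Y : Stack Γ} {P′} → ⊢W[ renS (wkOut cs) (renS (there {y = t}) Y) ] P′ →
    ⊢W[ renS (wkOut cs) Y ] ν t (renP (swapOut cs) P′)
  ⊢W-ν-swapOut cs {Y} d = wRes (⊢W-subst (renS-ext-there (wkOut cs) Y) (⊢W-swapOut cs d))

  ⊢W-νC-swapOut : ∀ {Γ t} cs (ξ σ′ : Stack Γ) {P′} → kind t ≡ co → EmptyOrEndsWith I ξ →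
    ⊢W[ renS (wkOut cs) (bodyStack t ξ σ′) ] P′ →
    ⊢W[ renS (wkOut cs) (ξ ++ σ′) ] ν t (renP (swapOut cs) P′)
  ⊢W-νC-swapOut cs ξ σ′ k c d = ⊢W-subst (sym (renS-++ (wkOut cs) ξ σ′))
    (wResC (renS (wkOut cs) ξ) (renS (wkOut cs) σ′) k (EmptyOrEndsWith-renS (wkOut cs) c)
      (⊢W-subst (renS-bodyStack (wkOut cs) ξ σ′) (⊢W-swapOut cs d)))

  renS-wkOut-there : ∀ {Γ t} cs (Y : Stack Γ) →
    renS (wkOut cs) (renS (there {y = t}) Y) ≡ renS (wkOut (t ∷ cs)) Y
  renS-wkOut-there cs Y = renS-∘ (wkOut cs) there Y

  input-ic : ∀ {Γ s} {a : Γ ∋ s} {b σ P P′} → kind s ≡ ic → ⊢W[ σ ] P → P —[ inA a b ]→ P′ →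
    ⊢W[ σ ] P′
  input-icG : ∀ {Γ s} {a : Γ ∋ s} {b σ G P′} → kind s ≡ ic → ⊢WG[ σ ] G → G —G[ inA a b ]→ P′ →
    ⊢W[ σ ] P′
  input-ic k (wRep _ ks _ _) tRep = ⊥-elim (oc≢ic (trans (sym ks) k))
  input-ic k (wGrd g) (tGrd t) = input-icG k g t
  input-ic k (wPar d₁ d₂ si) (tParL t) = wPar (input-ic k d₁ t) d₂ si
  input-ic k (wPar d₁ d₂ si) (tParR t) = wPar d₁ (input-ic k d₂ t) si
  input-ic k (wResC ξ σ′ kt c d) (tRes t) = wResC ξ σ′ kt c (input-ic k d t)
  input-ic k (wRes d) (tRes t) = wRes (input-ic k d t)
  input-icG k (wInC _ ks _ _ _) tInp = ⊥-elim (co≢ic (trans (sym ks) k))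
  input-icG k (wInX _ ks _ _) tInp = ⊥-elim (oc≢ic (trans (sym ks) k))
  input-icG {b = b} k (wInU p ks kp d) tInp =
    ⊢W-subst (cong (λ x → (O , (proj₁ p , x)) ∷ []) (inst-wkIn b (proj₂ p)))
      (⊢W-rename (inst b) (InjectiveOn-singleton _ _) d)
  input-icG k (wMatch g) (tMatch t) = input-icG k g t
  input-icG k (wSum g h _) (tSumL t) = input-icG k g t
  input-icG k (wSum g h _) (tSumR t) = input-icG k h t

  output-ic : ∀ {Γ cs s} {a : Γ ∋ s} {b σ P P′} → kind s ≡ ic → ⊢W[ σ ] P →
    P —[ outA cs a b ]→ P′ → ⊢W[ renS (wkOut cs) σ ] P′
  output-ic k (wOutP ks) tOut = ⊥-elim (co≢ic (trans (sym ks) k))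
  output-ic k (wOutX _ ks _) tOut = ⊥-elim (oc≢ic (trans (sym ks) k))
  output-ic k (wOutU _) tOut = wGrd wNil
  output-ic k (wGrd g) (tGrd t) = ⊥-elim (guard-no-output t)
  output-ic {cs = cs} k (wPar d₁ d₂ (st , i)) (tParL t) =
    wPar (output-ic k d₁ t) (⊢W-wkP cs d₂) (IsStack-wkOut cs st , Interleave-renS (wkOut cs) i)
  output-ic {cs = cs} k (wPar d₁ d₂ (st , i)) (tParR t) =
    wPar (⊢W-wkP cs d₁) (output-ic k d₂ t) (IsStack-wkOut cs st , Interleave-renS (wkOut cs) i)
  output-ic {cs = cs} k (wResC ξ σ′ kt c d) (tRes t) = ⊢W-νC-swapOut cs ξ σ′ kt c (output-ic k d t)
  output-ic {cs = cs} k (wRes d) (tRes t) = ⊢W-ν-swapOut cs (output-ic k d t)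
  output-ic k (wRes {σ = σ} d) (tOpen {cs = cs} t o) =
    ⊢W-subst (renS-wkOut-there cs σ) (output-ic k d t)
  output-ic {b = b} k (wResC ξ σ′ kt c d) (tOpen t o) =
    ⊥-elim (ArgOcc-non-continuation b (λ e → oc≢ic (trans (sym e) k)) o kt)

  ∈-renS-there⁻ : ∀ {Γ t g s} {a : Γ ∋ s} (σ : Stack Γ) →
    (g , (s , there {y = t} a)) ∈ renS there σ → (g , (s , a)) ∈ σ
  ∈-renS-there⁻ σ m with ∈-map⁻ (renEntry there) m
  ... | _ , m′ , refl = m′

  ∈-bodyStack-there⁻ : ∀ {Γ t g s} {a : Γ ∋ s} (ξ σ′ : Stack Γ) →
    (g , (s , there a)) ∈ bodyStack t ξ σ′ → (g , (s , a)) ∈ (ξ ++ σ′)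
  ∈-bodyStack-there⁻ ξ σ′ m with ∈-++⁻ (renS there ξ) m
  ... | inj₁ m₁ = ∈-++⁺ˡ (∈-renS-there⁻ ξ m₁)
  ... | inj₂ (there (there m₂)) = ∈-++⁺ʳ ξ (∈-renS-there⁻ σ′ m₂)

  input-co-∈ : ∀ {Γ s} {a : Γ ∋ s} {b σ P P′} → kind s ≡ co → ⊢W[ σ ] P → P —[ inA a b ]→ P′ →
    (I , (s , a)) ∈ σ
  input-co-∈G : ∀ {Γ s} {a : Γ ∋ s} {b σ G P′} → kind s ≡ co → ⊢WG[ σ ] G → G —G[ inA a b ]→ P′ →
    (I , (s , a)) ∈ σ
  input-co-∈ k (wRep _ ks _ _) tRep = ⊥-elim (co≢oc (trans (sym k) ks))
  input-co-∈ k (wGrd g) (tGrd t) = input-co-∈G k g t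
  input-co-∈ k (wPar d₁ d₂ (_ , i)) (tParL t) = Interleave-∈ˡ i (input-co-∈ k d₁ t)
  input-co-∈ k (wPar d₁ d₂ (_ , i)) (tParR t) = Interleave-∈ʳ i (input-co-∈ k d₂ t)
  input-co-∈ k (wResC ξ σ′ _ _ d) (tRes t) = ∈-bodyStack-there⁻ ξ σ′ (input-co-∈ k d t)
  input-co-∈ k (wRes {σ = σ} d) (tRes t) = ∈-renS-there⁻ σ (input-co-∈ k d t)
  input-co-∈G k (wInC _ _ _ _ _) tInp = here refl
  input-co-∈G k (wInX _ ks _ _) tInp = ⊥-elim (co≢oc (trans (sym k) ks))
  input-co-∈G k (wInU _ ks _ _) tInp = ⊥-elim (co≢ic (trans (sym k) ks))
  input-co-∈G k (wMatch g) (tMatch t) with input-co-∈G k g t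
  ... | ()
  input-co-∈G k (wSum g h _) (tSumL t) = input-co-∈G k g t
  input-co-∈G k (wSum g h _) (tSumR t) = input-co-∈G k h t

  input-co : ∀ {Γ s} {a : Γ ∋ s} {b σ ρ P P′} → kind s ≡ co → ⊢W[ σ ] P → P —[ inA a b ]→ P′ →
    σ ≡ (I , (s , a)) ∷ ρ → ⊢W[ ρ ] P′
  input-coG : ∀ {Γ s} {a : Γ ∋ s} {b σ ρ G P′} → kind s ≡ co → ⊢WG[ σ ] G → G —G[ inA a b ]→ P′ →
    σ ≡ (I , (s , a)) ∷ ρ → ⊢W[ ρ ] P′
  input-co k (wRep _ ks _ _) tRep eq = ⊥-elim (co≢oc (trans (sym k) ks))
  input-co k (wGrd g) (tGrd t) eq = input-coG k g t eq
  input-co k (wPar d₁ d₂ (st , i)) (tParL t) refl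
    with Interleave-headˡ i (input-co-∈ k d₁ t) (IsStack.oncePerTag st)
  ... | β , refl , i′ = wPar (input-co k d₁ t refl) d₂ (IsStack-tail st , i′)
  input-co k (wPar d₁ d₂ (st , i)) (tParR t) refl
    with Interleave-headʳ i (input-co-∈ k d₂ t) (IsStack.oncePerTag st)
  ... | β , refl , i′ = wPar d₁ (input-co k d₂ t refl) (IsStack-tail st , i′)
  input-co k (wRes d) (tRes t) refl = wRes (input-co k d t refl)
  input-co k (wResC [] _ _ _ d) (tRes t) refl with ⊢W⇒Alternating d
  ... | alO (O∷ I∷ ())
  input-co k (wResC (_ ∷ ξ) σ′ kt c d) (tRes t) refl =
    wResC ξ σ′ kt (EmptyOrEndsWith-tail c) (input-co k d t refl)
  input-coG {b = b} k (wInC p _ _ _ d) tInp refl =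
    ⊢W-subst (cong (λ x → (O , (proj₁ p , x)) ∷ []) (inst-wkIn b (proj₂ p)))
      (⊢W-rename (inst b) (InjectiveOn-singleton _ _) d)
  input-coG k (wInX _ ks _ _) tInp eq = ⊥-elim (co≢oc (trans (sym k) ks))
  input-coG k (wInU _ ks _ _) tInp eq = ⊥-elim (co≢ic (trans (sym k) ks))
  input-coG k (wMatch g) (tMatch t) ()
  input-coG k (wSum g h _) (tSumL t) eq = input-coG k g t eq
  input-coG k (wSum g h _) (tSumR t) eq = input-coG k h t eq

  PoppedO : ∀ {Γ} cs (n : Name Γ) (σ : Stack Γ) → Proc (cs ⊕ Γ) → Set
  PoppedO cs n σ P′ = ∃ λ ρ → σ ≡ (O , n) ∷ ρ × ⊢W[ renS (wkOut cs) ρ ] P′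

  PoppedO⇒⊢W : ∀ {Γ cs} {n : Name Γ} {σ ρ P′} → PoppedO cs n σ P′ → σ ≡ (O , n) ∷ ρ →
    ⊢W[ renS (wkOut cs) ρ ] P′
  PoppedO⇒⊢W (_ , refl , d′) refl = d′

  PoppedO-parˡ : ∀ {Γ cs s} {a : Γ ∋ s} {b} {σ σ₁ σ₂ : Stack Γ} {n P Q P′ η₁ η₂} →
    kind s ≢ ic → ⊢W[ σ₁ ] P → ⊢S[ η₁ ] P → ⊢W[ σ₂ ] Q → ⊢S[ η₂ ] Q → η₁ + η₂ ≤ 1 →
    IsStack σ → Interleave σ σ₁ σ₂ → P —[ outA cs a b ]→ P′ → PoppedO cs n σ₁ P′ →
    PoppedO cs n σ (P′ ∣ wkP cs Q)
  PoppedO-parˡ {cs = cs} k d₁ e₁ d₂ e₂ l st i t (ρ₁ , refl , d′)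
    with Interleave-head-O st i (⊢W⇒Alternating d₁) (⊢W⇒Alternating d₂)
           (seqTag-partner-zeroʳ d₂ e₂ (output-level k e₁ t) l)
  ... | ρ , refl , i′ =
    ρ , refl , wPar d′ (⊢W-wkP cs d₂) (IsStack-wkOut cs (IsStack-tail st) , Interleave-renS (wkOut cs) i′)

  PoppedO-parʳ : ∀ {Γ cs s} {a : Γ ∋ s} {b} {σ σ₁ σ₂ : Stack Γ} {n P Q Q′ η₁ η₂} →
    kind s ≢ ic → ⊢W[ σ₁ ] P → ⊢S[ η₁ ] P → ⊢W[ σ₂ ] Q → ⊢S[ η₂ ] Q → η₁ + η₂ ≤ 1 →
    IsStack σ → Interleave σ σ₁ σ₂ → Q —[ outA cs a b ]→ Q′ → PoppedO cs n σ₂ Q′ →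
    PoppedO cs n σ (wkP cs P ∣ Q′)
  PoppedO-parʳ {cs = cs} k d₁ e₁ d₂ e₂ l st i t (ρ₂ , refl , d′)
    with Interleave-head-O st (Interleave-swap i) (⊢W⇒Alternating d₂) (⊢W⇒Alternating d₁)
           (seqTag-partner-zeroˡ d₁ e₁ (output-level k e₂ t) l)
  ... | ρ , refl , i′ =
    ρ , refl , wPar (⊢W-wkP cs d₁) d′
                    (IsStack-wkOut cs (IsStack-tail st) , Interleave-renS (wkOut cs) (Interleave-swap i′))

  renS-there-∷⁻ : ∀ {Γ t g s} {a : Γ ∋ s} (σ : Stack Γ) {X} →
    renS (there {y = t}) σ ≡ (g , (s , there a)) ∷ X → ∃ λ ρ → σ ≡ (g , (s , a)) ∷ ρ × X ≡ renS there ρ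
  renS-there-∷⁻ ((g , s , a) ∷ σ) refl = σ , refl , refl

  bodyStack-∷⁻ : ∀ {Γ t g s} {a : Γ ∋ s} (ξ σ′ : Stack Γ) {X} →
    bodyStack t ξ σ′ ≡ (g , (s , there a)) ∷ X → ∃ λ ξ′ → ξ ≡ (g , (s , a)) ∷ ξ′ × X ≡ bodyStack t ξ′ σ′
  bodyStack-∷⁻ ((g , s , a) ∷ ξ) σ′ refl = ξ , refl , refl

  PoppedO-ν : ∀ {Γ t cs} {σ : Stack Γ} {n : Name Γ} {P′} →
    PoppedO cs (renName there n) (renS (there {y = t}) σ) P′ → PoppedO cs n σ (ν t (renP (swapOut cs) P′))
  PoppedO-ν {cs = cs} {σ} (ρ₁ , eq , d′) with renS-there-∷⁻ σ eq
  ... | ρ , refl , refl = ρ , refl , ⊢W-ν-swapOut cs d′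

  PoppedO-νC : ∀ {Γ t cs} (ξ σ′ : Stack Γ) {n : Name Γ} {P′} → kind t ≡ co → EmptyOrEndsWith I ξ →
    PoppedO cs (renName there n) (bodyStack t ξ σ′) P′ →
    PoppedO cs n (ξ ++ σ′) (ν t (renP (swapOut cs) P′))
  PoppedO-νC {cs = cs} ξ σ′ k c (ρ₁ , eq , d′) with bodyStack-∷⁻ ξ σ′ eq
  ... | ξ′ , refl , refl = ξ′ ++ σ′ , refl , ⊢W-νC-swapOut cs ξ′ σ′ k (EmptyOrEndsWith-tail c) d′

  PoppedO-open : ∀ {Γ t cs} {σ : Stack Γ} {n : Name Γ} {P′} →
    PoppedO cs (renName there n) (renS (there {y = t}) σ) P′ → PoppedO (t ∷ cs) n σ P′
  PoppedO-open {cs = cs} {σ} (ρ₁ , eq , d′) with renS-there-∷⁻ σ eq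
  ... | ρ , refl , refl = ρ , refl , ⊢W-subst (renS-wkOut-there cs ρ) d′

  output-co : ∀ {Γ cs s} {a : Γ ∋ s} {b σ P P′ η} → kind s ≡ co → ⊢W[ σ ] P → ⊢S[ η ] P →
    P —[ outA cs a b ]→ P′ → PoppedO cs (s , a) σ P′
  output-co k (wOutP _) _ tOut = [] , refl , wGrd wNil
  output-co k (wOutX _ ks _) _ tOut = ⊥-elim (co≢oc (trans (sym k) ks))
  output-co k (wOutU ks) _ tOut = ⊥-elim (co≢ic (trans (sym k) ks))
  output-co k (wGrd _) _ (tGrd t) = ⊥-elim (guard-no-output t)
  output-co k (wPar d₁ d₂ (st , i)) (sPar e₁ e₂ l) (tParL t) =
    PoppedO-parˡ (co≢ic ∘ trans (sym k)) d₁ e₁ d₂ e₂ l st i t (output-co k d₁ e₁ t)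
  output-co k (wPar d₁ d₂ (st , i)) (sPar e₁ e₂ l) (tParR t) =
    PoppedO-parʳ (co≢ic ∘ trans (sym k)) d₁ e₁ d₂ e₂ l st i t (output-co k d₂ e₂ t)
  output-co {cs = cs} k (wRes d) (sRes e) (tRes t) = PoppedO-ν {cs = cs} {n = _ , _} (output-co k d e t)
  output-co {cs = cs} k (wResC ξ σ′ kt c d) (sRes e) (tRes t) =
    PoppedO-νC {cs = cs} ξ σ′ {n = _ , _} kt c (output-co k d e t)
  output-co k (wRes d) (sRes e) (tOpen {cs = cs} t o) = PoppedO-open {cs = cs} {n = _ , _} (output-co k d e t)
  output-co {b = b} k (wResC ξ σ′ kt c d) (sRes e) (tOpen t o) =
    ⊥-elim (ArgOcc-non-continuation b (co≢oc ∘ trans (sym k)) o kt)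

  output-oc-old : ∀ {Γ cs s t} {a : Γ ∋ s} {b σ P P′ η} → kind s ≡ oc → (w : obj s ∋ t) → kind t ≡ co →
    (q : Γ ∋ t) → lookupAll b w ≡ wkOut cs q →
    ⊢W[ σ ] P → ⊢S[ η ] P → P —[ outA cs a b ]→ P′ → PoppedO cs (t , q) σ P′
  output-oc-old ks w kt q eq (wOutX w′ _ kt′) _ tOut with continuation-position-unique ks w′ w kt′ kt
  ... | refl = [] , cong (λ x → (O , (_ , x)) ∷ []) eq , wGrd wNil
  output-oc-old ks w kt q eq (wOutP k) _ tOut = ⊥-elim (co≢oc (trans (sym k) ks))
  output-oc-old ks w kt q eq (wOutU k) _ tOut = ⊥-elim (oc≢ic (trans (sym ks) k))
  output-oc-old ks w kt q eq (wGrd _) _ (tGrd t) = ⊥-elim (guard-no-output t)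
  output-oc-old ks w kt q eq (wPar d₁ d₂ (st , i)) (sPar e₁ e₂ l) (tParL t) =
    PoppedO-parˡ (oc≢ic ∘ trans (sym ks)) d₁ e₁ d₂ e₂ l st i t (output-oc-old ks w kt q eq d₁ e₁ t)
  output-oc-old ks w kt q eq (wPar d₁ d₂ (st , i)) (sPar e₁ e₂ l) (tParR t) =
    PoppedO-parʳ (oc≢ic ∘ trans (sym ks)) d₁ e₁ d₂ e₂ l st i t (output-oc-old ks w kt q eq d₂ e₂ t)
  output-oc-old {cs = cs} {b = b} ks w kt q eq (wRes d) (sRes e) (tRes t) =
    PoppedO-ν {cs = cs} {n = _ , _} (output-oc-old ks w kt (there q) (lookupAll-there-wkOut cs b w q eq) d e t)
  output-oc-old {cs = cs} {b = b} ks w kt q eq (wResC ξ σ′ kt₀ c d) (sRes e) (tRes t) =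
    PoppedO-νC {cs = cs} ξ σ′ {n = _ , _} kt₀ c (output-oc-old ks w kt (there q) (lookupAll-there-wkOut cs b w q eq) d e t)
  output-oc-old ks w kt q eq (wRes d) (sRes e) (tOpen {cs = cs} t o) =
    PoppedO-open {cs = cs} {n = _ , _} (output-oc-old ks w kt (there q) eq d e t)
  output-oc-old {b = b} ks w kt q eq (wResC ξ σ′ kt₀ c d) (sRes e) (tOpen {cs = cs} t o)
    with wkOut-injective cs (trans (ArgOcc-continuation b ks w kt o kt₀) (cong (_ ,_) eq))
  ... | ()

  ⊢W-swapOut-∷ : ∀ {Γ t₀} cs {g t} (v : (cs ⊕ Γ) ∋ t) {X : Stack (t₀ ∷ Γ)} {P′} →
    ⊢W[ (g , (t , ⊕-ext cs there v)) ∷ renS (wkOut cs) X ] P′ →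
    ⊢W[ (g , (t , there v)) ∷ renS (ext (wkOut cs)) X ] renP (swapOut cs) P′
  ⊢W-swapOut-∷ cs {g} {t} v {X} d = ⊢W-subst
    (cong₂ _∷_ (cong (λ x → g , t , x) (swapOut-⊕-ext-there cs v))
               (trans (renS-∘ (swapOut cs) (wkOut cs) X) (renS-cong (swapOut-wkOut cs) X)))
    (⊢W-rename (swapOut cs) (injective⇒InjectiveOn (swapOut-injective cs) _) d)

  IsStack-pushI-wkOut : ∀ {Γ} cs {σ : Stack Γ} {t} {p : (cs ⊕ Γ) ∋ t} → IsStack σ → kind t ≡ co →
    seqTag (tags σ) ≡ 1 → (¬ ∃ λ q → p ≡ wkOut cs q) → IsStack ((I , (t , p)) ∷ renS (wkOut cs) σ)
  IsStack-pushI-wkOut cs {σ} st kt sq fresh =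
    IsStack-consI (IsStack-wkOut cs st) kt (trans (cong seqTag (tags-renS _ σ)) sq) (fresh∉renS-wkOut cs fresh)

  EndsWith-pushI : ∀ {Γ Δ} (ρ : Ren Γ Δ) n ξ → EmptyOrEndsWith I ξ →
    EndsWith I ((I , n) ∷ renS ρ ξ)
  EndsWith-pushI ρ n .[] (inj₁ refl) = [] , n , refl
  EndsWith-pushI ρ n .(ξ₀ ∷ʳ (I , p)) (inj₂ (ξ₀ , p , refl)) =
    (I , n) ∷ renS ρ ξ₀ , renName ρ p , cong ((I , n) ∷_) (renS-++ ρ ξ₀ _)

  output-oc-fresh : ∀ {Γ cs s t} {a : Γ ∋ s} {b σ P P′ η} → kind s ≡ oc → (w : obj s ∋ t) →
    kind t ≡ co → (¬ ∃ λ (q : Γ ∋ t) → lookupAll b w ≡ wkOut cs q) →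
    ⊢W[ σ ] P → ⊢S[ η ] P → P —[ outA cs a b ]→ P′ →
    ⊢W[ (I , (t , lookupAll b w)) ∷ renS (wkOut cs) σ ] P′
  output-oc-fresh-under-ν : ∀ {Γ t₀} cs {s t} {a : Γ ∋ s} (b : Args (cs ⊕ Γ) (obj s)) (w : obj s ∋ t)
    {X : Stack (t₀ ∷ Γ)} {P P′ η} → kind s ≡ oc → kind t ≡ co →
    (¬ ∃ λ (q : Γ ∋ t) → lookupAll b w ≡ wkOut cs q) → ⊢W[ X ] P → ⊢S[ η ] P →
    P —[ wkAct (outA cs a b) ]→ P′ → ⊢W[ (I , (t , ⊕-ext cs there (lookupAll b w))) ∷ renS (wkOut cs) X ] P′
  output-oc-fresh-open : ∀ {Γ t₀ cs s t} {a : Γ ∋ s} {b} {σ : Stack Γ} {P : Proc (t₀ ∷ Γ)} {P′ η} →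
    kind s ≡ oc → (w : obj s ∋ t) → kind t ≡ co →
    (¬ ∃ λ (q : Γ ∋ t) → lookupAll b w ≡ wkOut (t₀ ∷ cs) q) → ⊢W[ σ ] ν t₀ P → ⊢S[ η ] P →
    P —[ outA cs (there a) b ]→ P′ → ArgOcc (wkOut cs (here {x = t₀} {xs = Γ})) b →
    ⊢W[ (I , (t , lookupAll b w)) ∷ renS (wkOut (t₀ ∷ cs)) σ ] P′

  output-oc-fresh-under-ν cs b w ks kt fresh d e t′ =
    ⊢W-subst (cong (λ x → (I , (_ , x)) ∷ _) (lookupAll-renA _ b w))
      (output-oc-fresh ks w kt
        (λ (q , eq) → fresh-⊕-ext-there cs fresh (q , trans (sym (lookupAll-renA _ b w)) eq)) d e t′)

  output-oc-fresh {b = b} ks w kt fresh _ _ tOut = ⊥-elim (fresh (lookupAll b w , refl))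
  output-oc-fresh ks w kt fresh (wGrd _) _ (tGrd t) = ⊥-elim (guard-no-output t)
  output-oc-fresh {cs = cs} ks w kt fresh d@(wPar d₁ d₂ (st , i)) e@(sPar e₁ e₂ l) (tParL t) =
    wPar (output-oc-fresh ks w kt fresh d₁ e₁ t) (⊢W-wkP cs d₂)
      (IsStack-pushI-wkOut cs st kt seq≡1 fresh , iL (Interleave-renS (wkOut cs) i))
    where
    seq≡1 = trans (sym (level≡seqTag d e)) (output-level (oc≢ic ∘ trans (sym ks)) e (tParL t))
  output-oc-fresh {cs = cs} ks w kt fresh d@(wPar d₁ d₂ (st , i)) e@(sPar e₁ e₂ l) (tParR t) =
    wPar (⊢W-wkP cs d₁) (output-oc-fresh ks w kt fresh d₂ e₂ t)
      (IsStack-pushI-wkOut cs st kt seq≡1 fresh , iR (Interleave-renS (wkOut cs) i))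
    where
    seq≡1 = trans (sym (level≡seqTag d e)) (output-level (oc≢ic ∘ trans (sym ks)) e (tParR t))
  output-oc-fresh {cs = cs} {b = b} ks w kt fresh (wRes {σ = σ} d) (sRes e) (tRes t′) =
    wRes (⊢W-subst (cong (_ ∷_) (renS-ext-there (wkOut cs) σ))
      (⊢W-swapOut-∷ cs (lookupAll b w) (output-oc-fresh-under-ν cs b w ks kt fresh d e t′)))
  output-oc-fresh {cs = cs} {b = b} ks w kt fresh (wResC ξ σ′ kt₀ c d) (sRes e) (tRes t′) =
    ⊢W-subst (cong (_ ∷_) (sym (renS-++ (wkOut cs) ξ σ′)))
      (wResC (_ ∷ renS (wkOut cs) ξ) (renS (wkOut cs) σ′) kt₀ (inj₂ (EndsWith-pushI (wkOut cs) _ ξ c))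
        (⊢W-subst (cong (_ ∷_) (renS-bodyStack (wkOut cs) ξ σ′))
          (⊢W-swapOut-∷ cs (lookupAll b w) (output-oc-fresh-under-ν cs b w ks kt fresh d e t′))))
  output-oc-fresh ks w kt fresh d (sRes e) (tOpen t′ o) = output-oc-fresh-open ks w kt fresh d e t′ o

  output-oc-fresh-open {cs = cs} {b = b} ks w kt fresh d e t′ o with wkOut? cs (lookupAll b w)
  ... | yes (there q , eq) = ⊥-elim (fresh (q , eq))
  -- The continuation is the name being opened: the body's stack must start with its pair p^O, p^I.
  output-oc-fresh-open ks w kt fresh (wRes {σ = σ} d) e t′ o | yes (here , eq)
    with output-oc-old ks w kt here eq d e t′
  ... | _ , eq′ , _ = ⊥-elim (renS-there-≢here σ eq′)
    where
    renS-there-≢here : ∀ {Γ t g} (σ : Stack Γ) {ρ} → renS (there {y = t}) σ ≢ (g , (t , here)) ∷ ρ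
    renS-there-≢here (_ ∷ _) ()
  output-oc-fresh-open {cs = cs} ks w kt fresh (wResC [] σ′ kt₀ c d) e t′ o | yes (here , eq)
    with output-oc-old ks w kt here eq d e t′
  ... | _ , refl , d′ = ⊢W-subst (cong₂ _∷_ (cong (λ x → (I , (_ , x))) (sym eq)) (renS-wkOut-there cs σ′)) d′
  output-oc-fresh-open ks w kt fresh (wResC (_ ∷ ξ) σ′ kt₀ c d) e t′ o | yes (here , eq)
    with output-oc-old ks w kt here eq d e t′
  ... | _ , () , _
  output-oc-fresh-open {cs = cs} ks w kt fresh (wRes {σ = σ} d) e t′ o | no fresh′ =
    ⊢W-subst (cong (_ ∷_) (renS-wkOut-there cs σ)) (output-oc-fresh ks w kt fresh′ d e t′)
  output-oc-fresh-open {cs = cs} {b = b} ks w kt fresh (wResC ξ σ′ kt₀ c d) e t′ o | no fresh′ =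
    ⊥-elim (fresh′ (old-here (ArgOcc-continuation b ks w kt o kt₀)))
    where
    old-here : ∀ {t} {p : (cs ⊕ _) ∋ t} → (_ , wkOut cs here) ≡ (t , p) → ∃ λ q → p ≡ wkOut cs q
    old-here refl = here , refl

  IsStack-[] : ∀ {Γ} → IsStack {Γ} []
  IsStack-[] = mkIsStack empty [] (λ _ ()) []

  OnlyAtHeadI : ∀ {Γ} → Name Γ → Stack Γ → Set
  OnlyAtHeadI p σ = p ∈S σ → ∃ λ ρ → σ ≡ (I , p) ∷ ρ

  OnlyAtHeadI-Interleaveˡ : ∀ {Γ} {σ σ₁ σ₂ : Stack Γ} {p} → IsStack σ → Interleave σ σ₁ σ₂ →
    OnlyAtHeadI p σ → OnlyAtHeadI p σ₁
  OnlyAtHeadI-Interleaveˡ {p = p} st i onlyHead m = at (proj₂ (∈S⇒∈ m))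
    where
    at : ∀ {g} → (g , p) ∈ _ → ∃ λ ρ → _ ≡ (I , p) ∷ ρ
    at {g} m with onlyHead (Interleave-∈Sˡ i (∈⇒∈S m))
    at {I} m | ρ , refl with Interleave-headˡ i m (IsStack.oncePerTag st)
    ... | β , refl , _ = β , refl
    at {O} m | ρ , refl with Interleave-∈ˡ i m
    ... | there m′ = ⊥-elim (I-head⇒O∉tail st m′)

  OnlyAtHeadI-renS-there : ∀ {Γ t} {p : Name Γ} (σ : Stack Γ) → OnlyAtHeadI p σ →
    OnlyAtHeadI (renName (there {y = t}) p) (renS there σ)
  OnlyAtHeadI-renS-there σ onlyHead m with ∈S-renS⁻ there σ m
  ... | _ , m′ , eq with renName-there-injective eq
  ... | refl with onlyHead m′
  ... | ρ , refl = renS there ρ , refl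

  OnlyAtHeadI-bodyStack : ∀ {Γ t} {p : Name Γ} e (ξ σ′ : Stack Γ) → OnlyAtHeadI p (e ∷ ξ ++ σ′) →
    OnlyAtHeadI (renName there p) (bodyStack t (e ∷ ξ) σ′)
  OnlyAtHeadI-bodyStack e ξ σ′ onlyHead m with ∈S-bodyStack⁻ (e ∷ ξ) σ′ m
  ... | inj₂ (_ , eq , m′) with renName-there-injective eq
  ... | refl with onlyHead m′
  ... | _ , refl = bodyStack _ ξ σ′ , refl

  input-ocG : ∀ {Γ s t} {a : Γ ∋ s} {b σ G P′} → kind s ≡ oc → (w : obj s ∋ t) → kind t ≡ co →
    (p : Γ ∋ t) → lookupAll b w ≡ p → ⊢WG[ σ ] G → G —G[ inA a b ]→ P′ → ⊢W[ (O , (t , p)) ∷ σ ] P′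
  input-ocG {b = b} ks w kt p eqp (wInX w′ _ kt′ d) tInp with continuation-position-unique ks w′ w kt′ kt
  ... | refl = ⊢W-subst (cong (λ x → (O , (_ , x)) ∷ []) (trans (inst-bnd b w) eqp))
                 (⊢W-rename (inst b) (InjectiveOn-singleton _ _) d)
  input-ocG ks w kt p eqp (wInC _ k _ _ _) tInp = ⊥-elim (co≢oc (trans (sym k) ks))
  input-ocG ks w kt p eqp (wInU _ k _ _) tInp = ⊥-elim (oc≢ic (trans (sym ks) k))
  input-ocG ks w kt p eqp (wMatch g) (tMatch t) = input-ocG ks w kt p eqp g t
  input-ocG ks w kt p eqp (wSum g h _) (tSumL t) = input-ocG ks w kt p eqp g t
  input-ocG ks w kt p eqp (wSum g h _) (tSumR t) = input-ocG ks w kt p eqp h t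

  input-oc : ∀ {Γ s t} {a : Γ ∋ s} {b σ P P′ η} → kind s ≡ oc → (w : obj s ∋ t) → kind t ≡ co →
    (p : Γ ∋ t) → lookupAll b w ≡ p → ⊢W[ σ ] P → ⊢S[ η ] P → P —[ inA a b ]→ P′ →
    seqTag (tags σ) ≡ 0 → OnlyAtHeadI (t , p) σ → ⊢W[ (O , (t , p)) ∷ σ ] P′
  input-oc {b = b} ks w kt p eqp (wRep w′ _ kt′ d) _ tRep _ _ with continuation-position-unique ks w′ w kt′ kt
  ... | refl = wPar (⊢W-subst (cong (λ x → (O , (_ , x)) ∷ []) (trans (inst-bnd b w) eqp))
                       (⊢W-rename (inst b) (InjectiveOn-singleton _ _) d))
                    (wRep w ks kt d)
                    (IsStack-consO IsStack-[] kt refl (λ ()) , iL iNil)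
  input-oc ks w kt p eqp (wGrd g) _ (tGrd t) _ _ = input-ocG ks w kt p eqp g t
  input-oc ks w kt p eqp d@(wPar d₁ d₂ (st , i)) e@(sPar {η₁ = η₁} e₁ e₂ l) (tParL t) z onlyHead =
    wPar (input-oc ks w kt p eqp d₁ e₁ t (trans (sym (level≡seqTag d₁ e₁)) (m+n≡0⇒m≡0 η₁ η≡0))
                   (OnlyAtHeadI-Interleaveˡ st i onlyHead))
         d₂ (IsStack-consO st kt z onlyHead , iL i)
    where η≡0 = trans (level≡seqTag d e) z
  input-oc ks w kt p eqp d@(wPar d₁ d₂ (st , i)) e@(sPar {η₁ = η₁} e₁ e₂ l) (tParR t) z onlyHead =
    wPar d₁ (input-oc ks w kt p eqp d₂ e₂ t (trans (sym (level≡seqTag d₂ e₂)) (m+n≡0⇒n≡0 η₁ η≡0))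
                      (OnlyAtHeadI-Interleaveˡ st (Interleave-swap i) onlyHead))
         (IsStack-consO st kt z onlyHead , iR i)
    where η≡0 = trans (level≡seqTag d e) z
  input-oc {b = b} ks w kt p eqp (wRes {σ = σ} d) (sRes e) (tRes t) z onlyHead =
    wRes (input-oc ks w kt (there p) (trans (lookupAll-renA there b w) (cong there eqp)) d e t
           (trans (cong seqTag (tags-renS there σ)) z) (OnlyAtHeadI-renS-there σ onlyHead))
  input-oc ks w kt p eqp (wResC [] σ′ kt₀ c d) (sRes e) (tRes t) z onlyHead with ⊢W⇒Alternating d
  ... | alO (O∷ I∷ a) = ⊥-elim (1+n≢0 (trans (sym (seqTag-AltO a)) (trans (cong seqTag (tags-renS there σ′)) z)))
  input-oc {b = b} ks w kt p eqp (wResC (e₀ ∷ ξ) σ′ kt₀ c d) (sRes e) (tRes t) z onlyHead =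
    wResC (_ ∷ e₀ ∷ ξ) σ′ kt₀ (inj₂ (ends c))
      (input-oc ks w kt (there p) (trans (lookupAll-renA there b w) (cong there eqp)) d e t
        (trans (seqTag-cong-head (proj₁ e₀) _ _) z) (OnlyAtHeadI-bodyStack e₀ ξ σ′ onlyHead))
    where
    ends : EmptyOrEndsWith I (e₀ ∷ ξ) → EndsWith I ((O , (_ , p)) ∷ e₀ ∷ ξ)
    ends (inj₂ (ξ₀ , q , eq)) = (O , (_ , p)) ∷ ξ₀ , q , cong (_ ∷_) eq

  ⊢W-νs : ∀ {Γ} cs {X : Stack Γ} {Y} → ⊢W[ renS (wkOut cs) X ] Y → ⊢W[ X ] νs cs Y
  ⊢W-νs [] {X} d = ⊢W-subst (renS-id X) d
  ⊢W-νs (c ∷ cs) {X} d = wRes (⊢W-νs cs {renS there X} (⊢W-subst (sym (renS-wkOut-there cs X)) d))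

  ⊢W-νs-close : ∀ {Γ} cs {t} {p : (cs ⊕ Γ) ∋ t} {X : Stack Γ} {Y} → kind t ≡ co →
    (¬ ∃ λ q → p ≡ wkOut cs q) →
    ⊢W[ (O , (t , p)) ∷ (I , (t , p)) ∷ renS (wkOut cs) X ] Y → ⊢W[ X ] νs cs Y
  ⊢W-νs-close [] {p = p} kt fresh d = ⊥-elim (fresh (p , refl))
  ⊢W-νs-close (c ∷ cs) {p = p} kt fresh d with wkOut? cs p
  ... | yes (there q , eq) = ⊥-elim (fresh (q , eq))
  ⊢W-νs-close (c ∷ cs) {p = p} {X} kt fresh d | yes (here , eq) =
    wResC [] X kt (inj₁ refl)
      (⊢W-νs cs (⊢W-subst (cong₂ (λ x y → (O , (_ , x)) ∷ (I , (_ , x)) ∷ y) eq (sym (renS-wkOut-there cs X))) d))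
  ⊢W-νs-close (c ∷ cs) {p = p} {X} kt fresh d | no fresh′ =
    wRes (⊢W-νs-close cs kt fresh′ (⊢W-subst (cong (λ y → _ ∷ _ ∷ y) (sym (renS-wkOut-there cs X))) d))

  ⊢W-νs-map : ∀ {Γ} cs {A B : Proc (cs ⊕ Γ)} → (∀ {σ} → ⊢W[ σ ] A → ⊢W[ σ ] B) →
    ∀ {σ : Stack Γ} → ⊢W[ σ ] νs cs A → ⊢W[ σ ] νs cs B
  ⊢W-νs-map [] f d = f d
  ⊢W-νs-map (c ∷ cs) f (wResC ξ σ′ k c′ d) = wResC ξ σ′ k c′ (⊢W-νs-map cs f d)
  ⊢W-νs-map (c ∷ cs) f (wRes d) = wRes (⊢W-νs-map cs f d)

  ⊢W-∣-comm : ∀ {Γ} {σ : Stack Γ} {A B} → ⊢W[ σ ] (A ∣ B) → ⊢W[ σ ] (B ∣ A)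
  ⊢W-∣-comm (wPar d₁ d₂ (st , i)) = wPar d₂ d₁ (st , Interleave-swap i)

  AfterTau : ∀ {Γ} → Stack Γ → Proc Γ → Set
  AfterTau σ X = ⊢W[ σ ] X ⊎ ∃₂ λ n ρ → σ ≡ (O , n) ∷ (I , n) ∷ ρ × ⊢W[ ρ ] X ×
    kind (proj₁ n) ≡ co × (n ∈S ρ → ⊥)

  AfterTau-map : ∀ {Γ} {σ : Stack Γ} {A B} → (∀ {σ} → ⊢W[ σ ] A → ⊢W[ σ ] B) →
    AfterTau σ A → AfterTau σ B
  AfterTau-map f = map₁ f ∘ map₂ (λ (n , ρ , eq , d , k , n∉ρ) → n , ρ , eq , f d , k , n∉ρ)

  popped-pair : ∀ {Γ} {n : Name Γ} {ρ} → IsStack ((O , n) ∷ (I , n) ∷ ρ) →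
    kind (proj₁ n) ≡ co × (n ∈S ρ → ⊥)
  popped-pair st with IsStack.continuation st
  ... | k ∷ _ = k , n∉ρ
    where
    n∉ρ : _ → ⊥
    n∉ρ m with ∈S⇒∈ m
    ... | O , m′ = head∉tail st (there m′)
    ... | I , m′ = head∉tail (IsStack-tail st) m′

  ∈-renS-injective⁻ : ∀ {Γ Δ} {ρ : Ren Γ Δ} → RenInjective ρ → ∀ {g n} (σ : Stack Γ) →
    (g , renName ρ n) ∈ renS ρ σ → (g , n) ∈ σ
  ∈-renS-injective⁻ inj σ m with ∈-map⁻ (renEntry _) m
  ... | _ , m′ , eq with cong proj₁ eq | inj (cong proj₂ eq)
  ... | refl | refl = m′

  communication-co : ∀ {Γ cs s} {a : Γ ∋ s} {b} {σ σ₁ σ₂ : Stack Γ} {P Q P′ Q′ η₁ η₂} → kind s ≡ co →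
    ⊢W[ σ₁ ] P → ⊢S[ η₁ ] P → ⊢W[ σ₂ ] Q → ⊢S[ η₂ ] Q → η₁ + η₂ ≤ 1 → IsStack σ →
    Interleave σ σ₁ σ₂ → P —[ outA cs a b ]→ P′ → wkP cs Q —[ inA (wkOut cs a) b ]→ Q′ →
    ∃ λ ρ → σ ≡ (O , (s , a)) ∷ (I , (s , a)) ∷ ρ × ⊢W[ ρ ] νs cs (P′ ∣ Q′)
  communication-co {cs = cs} k d₁ e₁ d₂ e₂ l st i tP tQ with output-co k d₁ e₁ tP
  ... | ρ₁ , refl , dP
    with Interleave-head-O st i (⊢W⇒Alternating d₁) (⊢W⇒Alternating d₂)
           (seqTag-partner-zeroʳ d₂ e₂ (output-level (co≢ic ∘ trans (sym k)) e₁ tP) l)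
  ... | ρ′ , refl , i′ with ∈-renS-injective⁻ (wkOut-injective cs) _ (input-co-∈ k (⊢W-wkP cs d₂) tQ)
  ... | aᴵ∈σ₂ with O-head⇒I-next st (Interleave-∈ʳ i′ aᴵ∈σ₂)
  ... | ρ , refl with Interleave-headʳ i′ aᴵ∈σ₂ (IsStack.oncePerTag (IsStack-tail st))
  ... | β , refl , i″ =
    ρ , refl , ⊢W-νs cs (wPar dP (input-co k (⊢W-wkP cs d₂) tQ refl)
                          (IsStack-wkOut cs (IsStack-tail (IsStack-tail st)) , Interleave-renS (wkOut cs) i″))

  communication-oc-old : ∀ {Γ cs s t} {a : Γ ∋ s} {b} {σ σ₁ σ₂ : Stack Γ} {P Q P′ Q′ η₁ η₂} →
    kind s ≡ oc → (w : obj s ∋ t) → kind t ≡ co → (q : Γ ∋ t) → lookupAll b w ≡ wkOut cs q →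
    ⊢W[ σ₁ ] P → ⊢S[ η₁ ] P → ⊢W[ σ₂ ] Q → ⊢S[ η₂ ] Q → η₁ + η₂ ≤ 1 → IsStack σ →
    Interleave σ σ₁ σ₂ → P —[ outA cs a b ]→ P′ → wkP cs Q —[ inA (wkOut cs a) b ]→ Q′ →
    ⊢W[ σ ] νs cs (P′ ∣ Q′)
  communication-oc-old {cs = cs} {t = t} {σ₂ = σ₂} ks w kt q eq d₁ e₁ d₂ e₂ l st i tP tQ
    with output-oc-old ks w kt q eq d₁ e₁ tP
  ... | ρ₁ , refl , dP
    with Interleave-head-O st i (⊢W⇒Alternating d₁) (⊢W⇒Alternating d₂)
           (seqTag-partner-zeroʳ d₂ e₂ (output-level (oc≢ic ∘ trans (sym ks)) e₁ tP) l)
  ... | ρ′ , refl , i′ = ⊢W-νs cs (wPar dP dQ (IsStack-wkOut cs st , iR (Interleave-renS (wkOut cs) i′)))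
    where
    seq₂≡0 = seqTag-partner-zeroʳ d₂ e₂ (output-level (oc≢ic ∘ trans (sym ks)) e₁ tP) l
    onlyHead : OnlyAtHeadI (t , q) σ₂
    onlyHead m with ∈S⇒∈ m
    ... | O , m′ = ⊥-elim (head∉tail st (Interleave-∈ʳ i′ m′))
    ... | I , m′ with O-head⇒I-next st (Interleave-∈ʳ i′ m′)
    ... | _ , refl with Interleave-headʳ i′ m′ (IsStack.oncePerTag (IsStack-tail st))
    ... | β , refl , _ = β , refl
    onlyHead-wk : OnlyAtHeadI (t , wkOut cs q) (renS (wkOut cs) σ₂)
    onlyHead-wk m with ∈S-renS⁻ (wkOut cs) σ₂ m
    ... | n , m′ , eq′ with wkOut-injective cs {t , q} {n} eq′
    ... | refl with onlyHead m′
    ... | β , refl = renS (wkOut cs) β , refl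
    dQ = input-oc ks w kt (wkOut cs q) eq (⊢W-wkP cs d₂) (⊢S-wkP cs e₂) tQ
           (trans (cong seqTag (tags-renS _ σ₂)) seq₂≡0) onlyHead-wk

  communication-oc-fresh : ∀ {Γ cs s t} {a : Γ ∋ s} {b} {σ σ₁ σ₂ : Stack Γ} {P Q P′ Q′ η₁ η₂} →
    kind s ≡ oc → (w : obj s ∋ t) → kind t ≡ co → (¬ ∃ λ (q : Γ ∋ t) → lookupAll b w ≡ wkOut cs q) →
    ⊢W[ σ₁ ] P → ⊢S[ η₁ ] P → ⊢W[ σ₂ ] Q → ⊢S[ η₂ ] Q → η₁ + η₂ ≤ 1 → IsStack σ →
    Interleave σ σ₁ σ₂ → P —[ outA cs a b ]→ P′ → wkP cs Q —[ inA (wkOut cs a) b ]→ Q′ →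
    ⊢W[ σ ] νs cs (P′ ∣ Q′)
  communication-oc-fresh {cs = cs} {b = b} {σ = σ} {σ₂ = σ₂} ks w kt fresh d₁ e₁ d₂ e₂ l st i tP tQ =
    ⊢W-νs-close cs kt fresh (wPar dP dQ (IsStack-consO stI kt refl (λ _ → _ , refl) , iR (iL (Interleave-renS (wkOut cs) i))))
    where
    level₁≡1 = output-level (oc≢ic ∘ trans (sym ks)) e₁ tP
    seq≡1 : seqTag (tags σ) ≡ 1
    seq≡1 = trans (sym (level≡seqTag (wPar d₁ d₂ (st , i)) (sPar e₁ e₂ l)))
                  (cong₂ _+_ level₁≡1 (1+n≤1⇒n≡0 level₁≡1 l))
    stI = IsStack-pushI-wkOut cs st kt seq≡1 fresh
    dP = output-oc-fresh ks w kt fresh d₁ e₁ tP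
    dQ = input-oc ks w kt (lookupAll b w) refl (⊢W-wkP cs d₂) (⊢S-wkP cs e₂) tQ
           (trans (cong seqTag (tags-renS _ σ₂)) (seqTag-partner-zeroʳ d₂ e₂ level₁≡1 l))
           (⊥-elim ∘ fresh∉renS-wkOut cs fresh)

  communication : ∀ {Γ cs s} {a : Γ ∋ s} {b} {σ σ₁ σ₂ : Stack Γ} {P Q P′ Q′ η₁ η₂} →
    ⊢W[ σ₁ ] P → ⊢S[ η₁ ] P → ⊢W[ σ₂ ] Q → ⊢S[ η₂ ] Q → η₁ + η₂ ≤ 1 → IsStack σ →
    Interleave σ σ₁ σ₂ → P —[ outA cs a b ]→ P′ → wkP cs Q —[ inA (wkOut cs a) b ]→ Q′ →
    AfterTau σ (νs cs (P′ ∣ Q′))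
  communication {cs = cs} {s} {b = b} d₁ e₁ d₂ e₂ l st i tP tQ with kind s in k
  ... | ic = inj₁ (⊢W-νs cs (wPar (output-ic k d₁ tP) (input-ic k (⊢W-wkP cs d₂) tQ)
                               (IsStack-wkOut cs st , Interleave-renS (wkOut cs) i)))
  ... | co with communication-co k d₁ e₁ d₂ e₂ l st i tP tQ
  ...   | ρ , refl , d = inj₂ (_ , ρ , refl , d , popped-pair st)
  communication {cs = cs} {s} {b = b} d₁ e₁ d₂ e₂ l st i tP tQ | oc with continuation-position k
  ... | t , w , kt with wkOut? cs (lookupAll b w)
  ...   | yes (q , eq) = inj₁ (communication-oc-old k w kt q eq d₁ e₁ d₂ e₂ l st i tP tQ)
  ...   | no fresh = inj₁ (communication-oc-fresh k w kt fresh d₁ e₁ d₂ e₂ l st i tP tQ)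

  AfterTau-parˡ : ∀ {Γ} {σ σ₁ σ₂ : Stack Γ} {P Q P′ η₁ η₂} →
    ⊢W[ σ₁ ] P → ⊢S[ η₁ ] P → ⊢W[ σ₂ ] Q → ⊢S[ η₂ ] Q → η₁ + η₂ ≤ 1 → IsStack σ →
    Interleave σ σ₁ σ₂ → AfterTau σ₁ P′ → AfterTau σ (P′ ∣ Q)
  AfterTau-parˡ d₁ e₁ d₂ e₂ l st i (inj₁ d′) = inj₁ (wPar d′ d₂ (st , i))
  AfterTau-parˡ d₁ e₁ d₂ e₂ l st i (inj₂ (n , ρ₁ , refl , d′ , _))
    with Interleave-head-O st i (⊢W⇒Alternating d₁) (⊢W⇒Alternating d₂)
           (seqTag-partner-zeroʳ d₂ e₂ (level≡seqTag d₁ e₁) l)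
  ... | ρ′ , refl , i′ with O-head⇒I-next st (Interleave-∈ˡ i′ (here refl))
  ... | ρ , refl with Interleave-headˡ i′ (here refl) (IsStack.oncePerTag (IsStack-tail st))
  ... | β , refl , i″ = inj₂ (n , ρ , refl , wPar d′ d₂ (IsStack-tail (IsStack-tail st) , i″) , popped-pair st)

  AfterTau-ν : ∀ {Γ t} {σ : Stack Γ} {P′} → AfterTau (renS (there {y = t}) σ) P′ → AfterTau σ (ν t P′)
  AfterTau-ν (inj₁ d′) = inj₁ (wRes d′)
  AfterTau-ν {σ = σ} (inj₂ (_ , ρ₁ , eq , d′ , k , n∉ρ₁)) = pop σ eq
    where
    pop : ∀ σ → renS there σ ≡ (O , _) ∷ (I , _) ∷ ρ₁ → AfterTau σ _
    pop ((O , s₁ , a₁) ∷ (I , .s₁ , .a₁) ∷ ρ) refl =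
      inj₂ ((s₁ , a₁) , ρ , refl , wRes d′ , k , n∉ρ₁ ∘ ∈S-renS⁺ there)

  AfterTau-νC : ∀ {Γ t} (ξ σ′ : Stack Γ) {P′} → kind t ≡ co → EmptyOrEndsWith I ξ →
    AfterTau (bodyStack t ξ σ′) P′ → AfterTau (ξ ++ σ′) (ν t P′)
  AfterTau-νC ξ σ′ kt c (inj₁ d′) = inj₁ (wResC ξ σ′ kt c d′)
  AfterTau-νC ξ σ′ kt c (inj₂ (_ , ρ₁ , eq , d′ , k , n∉ρ₁)) = pop ξ eq c
    where
    pop : ∀ ξ → bodyStack _ ξ σ′ ≡ (O , _) ∷ (I , _) ∷ ρ₁ → EmptyOrEndsWith I ξ → AfterTau (ξ ++ σ′) _
    -- The popped pair is that of the restricted continuation itself.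
    pop [] refl c = inj₁ (wRes d′)
    pop ((O , s₁ , a₁) ∷ (I , .s₁ , .a₁) ∷ ξ″) refl c =
      inj₂ ((s₁ , a₁) , ξ″ ++ σ′ , refl , wResC ξ″ σ′ kt (EmptyOrEndsWith-tail (EmptyOrEndsWith-tail c)) d′ , k , n∉ξ″σ′)
      where
      n∉ξ″σ′ : (s₁ , a₁) ∈S (ξ″ ++ σ′) → ⊥
      n∉ξ″σ′ m with Anyₚ.++⁻ ξ″ m
      ... | inj₁ m₁ = n∉ρ₁ (Anyₚ.++⁺ˡ (∈S-renS⁺ there m₁))
      ... | inj₂ m₂ = n∉ρ₁ (Anyₚ.++⁺ʳ (renS there ξ″) (there (there (∈S-renS⁺ there m₂))))

  silent-stepG : ∀ {Γ} {σ : Stack Γ} {G P′} → ⊢WG[ σ ] G → G —G[ τ ]→ P′ → ⊢W[ σ ] P′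
  silent-stepG (wTau d _) tTau = d
  silent-stepG (wMatch g) (tMatch t) = silent-stepG g t
  silent-stepG (wSum g h _) (tSumL t) = silent-stepG g t
  silent-stepG (wSum g h _) (tSumR t) = silent-stepG h t

  silent-step : ∀ {Γ} {σ : Stack Γ} {P P′ η} → ⊢W[ σ ] P → ⊢S[ η ] P → P —[ τ ]→ P′ → AfterTau σ P′
  silent-step (wGrd g) _ (tGrd t) = inj₁ (silent-stepG g t)
  silent-step (wPar d₁ d₂ (st , i)) (sPar e₁ e₂ l) (tParL t) =
    AfterTau-parˡ d₁ e₁ d₂ e₂ l st i (silent-step d₁ e₁ t)
  silent-step (wPar d₁ d₂ (st , i)) (sPar {η₁ = η₁} {η₂} e₁ e₂ l) (tParR t) =
    AfterTau-map ⊢W-∣-comm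
      (AfterTau-parˡ d₂ e₂ d₁ e₁ (subst (_≤ 1) (+-comm η₁ η₂) l) st (Interleave-swap i) (silent-step d₂ e₂ t))
  silent-step (wPar d₁ d₂ (st , i)) (sPar e₁ e₂ l) (tComL tP tQ) = communication d₁ e₁ d₂ e₂ l st i tP tQ
  silent-step (wPar d₁ d₂ (st , i)) (sPar {η₁ = η₁} {η₂} e₁ e₂ l) (tComR {cs = cs} tQ tP) =
    AfterTau-map (⊢W-νs-map cs ⊢W-∣-comm)
      (communication d₂ e₂ d₁ e₁ (subst (_≤ 1) (+-comm η₁ η₂) l) st (Interleave-swap i) tQ tP)
  silent-step (wRes d) (sRes e) (tRes t) = AfterTau-ν (silent-step d e t)
  silent-step (wResC ξ σ′ kt c d) (sRes e) (tRes t) = AfterTau-νC ξ σ′ kt c (silent-step d e t)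

  wkIn≢bnd : ∀ {Γ} ss {t t′} (v : Γ ∋ t) (w : ss ∋ t′) →
    _≡_ {A = Name (ss ++ Γ)} (t′ , bnd w) (t , wkIn ss v) → ⊥
  wkIn≢bnd (s ∷ ss) v here ()
  wkIn≢bnd (s ∷ ss) v (there w) eq = wkIn≢bnd ss v w (renName-there-injective eq)

  stack-name-free : ∀ {Γ} {σ : Stack Γ} {P g} {n : Name Γ} → ⊢W[ σ ] P → (g , n) ∈ σ → FrP (proj₂ n) P
  stack-name-freeG : ∀ {Γ} {σ : Stack Γ} {G g} {n : Name Γ} → ⊢WG[ σ ] G → (g , n) ∈ σ → FrG (proj₂ n) G
  stack-name-free (wOutP _) (here refl) = outS refl
  stack-name-free {P = out a b} (wOutX w _ _) (here refl) = outO (ArgOcc-lookupAll b w)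
  stack-name-free (wPar d₁ d₂ (_ , i)) m with Interleave-∈⁻ i m
  ... | inj₁ m₁ = parL (stack-name-free d₁ m₁)
  ... | inj₂ m₂ = parR (stack-name-free d₂ m₂)
  stack-name-free (wResC ξ σ′ _ _ d) m with ∈-++⁻ ξ m
  ... | inj₁ m₁ = res (stack-name-free d (∈-++⁺ˡ (∈-map⁺ (renEntry there) m₁)))
  ... | inj₂ m₂ = res (stack-name-free d (∈-++⁺ʳ (renS there ξ) (there (there (∈-map⁺ (renEntry there) m₂)))))
  stack-name-free (wRes d) m = res (stack-name-free d (∈-map⁺ (renEntry there) m))
  stack-name-free (wGrd g) m = grd (stack-name-freeG g m)
  stack-name-freeG (wInC p _ _ _ d) (here refl) = inS refl
  stack-name-freeG (wInC p _ _ _ d) (there (here refl)) = inB (stack-name-free d (here refl))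
  stack-name-freeG (wInU p _ _ d) (here refl) = inB (stack-name-free d (here refl))
  stack-name-freeG (wTau d _) m = tauB (stack-name-free d m)
  stack-name-freeG (wSum g _ _) m = sumL (stack-name-freeG g m)

  free-continuation∈stack : ∀ {Γ} {σ : Stack Γ} {P t} {v : Γ ∋ t} → ⊢W[ σ ] P → FrP v P →
    kind t ≡ co → (t , v) ∈S σ
  free-continuation∈stackG : ∀ {Γ} {σ : Stack Γ} {G t} {v : Γ ∋ t} → ⊢WG[ σ ] G → FrG v G →
    kind t ≡ co → (t , v) ∈S σ
  free-continuation∈stack (wOutP k) (outS eq) kt = here (sym eq)
  free-continuation∈stack {P = out a b} (wOutP k) (outO o) kt =
    ⊥-elim (ArgOcc-non-continuation b (co≢oc ∘ trans (sym k)) o kt)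
  free-continuation∈stack (wOutX w ks kt′) (outS refl) kt = ⊥-elim (co≢oc (trans (sym kt) ks))
  free-continuation∈stack {P = out a b} (wOutX w ks kt′) (outO o) kt =
    here (sym (ArgOcc-continuation b ks w kt′ o kt))
  free-continuation∈stack (wOutU k) (outS refl) kt = ⊥-elim (co≢ic (trans (sym kt) k))
  free-continuation∈stack {P = out a b} (wOutU k) (outO o) kt =
    ⊥-elim (ArgOcc-non-continuation b (λ e → oc≢ic (trans (sym e) k)) o kt)
  free-continuation∈stack (wRep w ks kt′ d) (repS refl) kt = ⊥-elim (co≢oc (trans (sym kt) ks))
  free-continuation∈stack {v = v} (wRep {s = s} w ks kt′ d) (repB f) kt with free-continuation∈stack d f kt
  ... | here eq = ⊥-elim (wkIn≢bnd (obj s) v w eq)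
  free-continuation∈stack (wPar d₁ d₂ (_ , i)) (parL f) kt = Interleave-∈Sˡ i (free-continuation∈stack d₁ f kt)
  free-continuation∈stack (wPar d₁ d₂ (_ , i)) (parR f) kt = Interleave-∈Sʳ i (free-continuation∈stack d₂ f kt)
  free-continuation∈stack (wResC ξ σ′ _ _ d) (res f) kt with ∈S-bodyStack⁻ ξ σ′ (free-continuation∈stack d f kt)
  ... | inj₂ (_ , refl , m) = m
  free-continuation∈stack (wRes {σ = σ} d) (res f) kt with ∈S-renS⁻ there σ (free-continuation∈stack d f kt)
  ... | _ , m , refl = m
  free-continuation∈stack (wGrd g) (grd f) kt = free-continuation∈stackG g f kt
  free-continuation∈stackG (wInC p _ _ _ d) (inS eq) kt = here (sym eq)
  free-continuation∈stackG (wInC {s = s} p _ _ _ d) (inB f) kt with free-continuation∈stack d f kt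
  ... | here eq = there (here (wkIn-injective (obj s) eq))
  free-continuation∈stackG (wInX w ks _ d) (inS refl) kt = ⊥-elim (co≢oc (trans (sym kt) ks))
  free-continuation∈stackG {v = v} (wInX {s = s} w ks _ d) (inB f) kt with free-continuation∈stack d f kt
  ... | here eq = ⊥-elim (wkIn≢bnd (obj s) v w eq)
  free-continuation∈stackG (wInU p ks _ d) (inS refl) kt = ⊥-elim (co≢ic (trans (sym kt) ks))
  free-continuation∈stackG (wInU {s = s} p _ _ d) (inB f) kt with free-continuation∈stack d f kt
  ... | here eq = here (wkIn-injective (obj s) eq)
  free-continuation∈stackG (wMatch g) (matchL {n = ¬co} refl) kt = ⊥-elim (¬co kt)
  free-continuation∈stackG (wMatch g) (matchR {n = ¬co} refl) kt = ⊥-elim (¬co kt)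
  free-continuation∈stackG (wMatch g) (matchB f) kt with free-continuation∈stackG g f kt
  ... | ()
  free-continuation∈stackG (wTau d _) (tauB f) kt = free-continuation∈stack d f kt
  free-continuation∈stackG (wSum g _ _) (sumL f) kt = free-continuation∈stackG g f kt
  free-continuation∈stackG (wSum _ h _) (sumR f) kt = free-continuation∈stackG h f kt

  input-oc-typed : ∀ {Γ s t} {a : Γ ∋ s} {b σ P P′} → σ ⊢W P —[ inA a b ]→ P′ → kind s ≡ oc →
    (w : obj s ∋ t) → kind t ≡ co → ⊢W[ (O , (t , lookupAll b w)) ∷ σ ] P′
  input-oc-typed {b = b} {σ} tt ks w kt =
    input-oc ks w kt (lookupAll b w) refl typed (_⊢S_—[_]→_.typed seqTrans) (_⊢S_—[_]→_.trans seqTrans)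
      seq≡0 onlyHead
    where
    open _⊢W_—[_]→_ tt
    seq≡0 : seqTag (tags σ) ≡ 0
    seq≡0 with _⊢S_—[_]→_.allowed seqTrans
    ... | inj₁ seq≡0 = trans (sym (seq≡seqTag σ)) seq≡0
    ... | inj₂ (inj₂ (_ , allowed-ic)) = ⊥-elim (oc≢ic (trans (sym ks) allowed-ic))
    onlyHead : OnlyAtHeadI (_ , lookupAll b w) σ
    onlyHead m with contCond (_ , lookupAll b w) kt (inj₂ (ArgOcc-lookupAll b w)) m
    ... | I , σ₁ , eqσ , _ = σ₁ , eqσ
    ... | O , σ₁ , refl , _ = ⊥-elim (1+n≢0 seq≡0)

  silent-step-pop : ∀ {Γ} {σ ρ : Stack Γ} {P P′ η} {p : Name Γ} → ⊢W[ σ ] P → ⊢S[ η ] P →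
    P —[ τ ]→ P′ → σ ≡ (O , p) ∷ (I , p) ∷ ρ → ¬ FrP (proj₂ p) P′ → ⊢W[ ρ ] P′
  silent-step-pop d e t eqσ p∉P′ with silent-step d e t
  ... | inj₁ d′ = ⊥-elim (p∉P′ (stack-name-free d′ (subst ((O , _) ∈_) (sym eqσ) (here refl))))
  ... | inj₂ (_ , _ , eq′ , d′ , _) = ⊢W-subst (sym (∷-injectiveʳ (∷-injectiveʳ (trans (sym eqσ) eq′)))) d′

  silent-step-keep : ∀ {Γ} {σ : Stack Γ} {P P′ η} → ⊢W[ σ ] P → ⊢S[ η ] P → P —[ τ ]→ P′ →
    ¬ (∃₂ λ (p : Name Γ) ρ → σ ≡ (O , p) ∷ (I , p) ∷ ρ × ¬ FrP (proj₂ p) P′) → ⊢W[ σ ] P′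
  silent-step-keep d e t no-pop with silent-step d e t
  ... | inj₁ d′ = d′
  ... | inj₂ (n , ρ , eqσ , d′ , k , n∉ρ) = ⊥-elim (no-pop (n , ρ , eqσ , λ f → n∉ρ (free-continuation∈stack d′ f k)))

mainTheorem9 : (𝒮 : Sorting) → let open Pi 𝒮 in
    ∀ {Γ : Ctx} {σ : Stack Γ} {P : Proc Γ} {μ : Act Γ}
      {σ′ : Stack (tgt μ)} {P′ : Proc (tgt μ)} →
    ⊢W[ σ ] P → ⟨ σ ⨾ P ⟩—[ μ ]→⟨ σ′ ⨾ P′ ⟩ → ⊢W[ σ′ ] P′
mainTheorem9 𝒮 {σ = σ} {μ = μ} {P′ = P′} d step = preserved update
  where
  open Pi 𝒮
  open SubjectReduction 𝒮
  open ⟨_⨾_⟩—[_]→⟨_⨾_⟩ step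
  open _⊢W_—[_]→_ typedTrans
  open _⊢S_—[_]→_ seqTrans renaming (typed to ⊢S-typed; trans to transition)

  preserved : ∀ {σ′} → Upd σ μ P′ σ′ → ⊢W[ σ′ ] P′
  preserved (uOutC {cs = cs} k eqσ) = PoppedO⇒⊢W {cs = cs} (output-co k d ⊢S-typed transition) eqσ
  preserved (uOutXe w ks kt fresh) = output-oc-fresh ks w kt fresh d ⊢S-typed transition
  preserved (uOutXn {cs = cs} w ks kt q eq eqσ) =
    PoppedO⇒⊢W {cs = cs} (output-oc-old ks w kt q eq d ⊢S-typed transition) eqσ
  preserved (uOutU k) = output-ic k d transition
  preserved (uInC k eqσ) = input-co k d transition eqσ
  preserved (uInX w ks kt) = input-oc-typed typedTrans ks w kt
  preserved (uInU k) = input-ic k d transition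
  preserved (uTauPop eqσ p∉P′) = silent-step-pop d ⊢S-typed transition eqσ p∉P′
  preserved (uTauKeep no-pop) = silent-step-keep d ⊢S-typed transition no-pop
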